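{- The bilinear pairing $\langle\!\langle\cdot,\cdot\rangle\!\rangle:\Gamma_n\times\Theta_n\to R$ satisfies $\langle\!\langle \beta,\alpha\rangle\!\rangle=0$ for all $\beta\in\Gamma_n$ and all $\alpha\in J_n$.
   Context: Let $R$ be a commutative ring with unit, $X=\{x_1<\dots<x_n\}$. A 2v-colored binary tree on $X$ is a planar (ordered) binary tree whose leaves are bijectively labeled by $X$ and whose internal vertices (each having a left and a right child) are colored red or blue; these correspond bijectively to formal monomials in two binary operations $[\cdot,\cdot]$ (red) and $\langle\cdot,\cdot\rangle$ (blue) containing each letter exactly once (the root of $\{m_1,m_2\}$ has left subtree $m_1$, right subtree $m_2$). $\Theta_n$ is the free $R$-module on these trees. $\mathscr{Lie}_2(n)$ is the multilinear part of the free $R$-algebra on $X$ with two brackets subject only to (S1) $[x,y]+[y,x]=0$, (S2) $\langle x,y\rangle+\langle y,x\rangle=0$, (J1) $[x,[y,z]]+[y,[z,x]]+[z,[x,y]]=0$, (J2) the same for $\langle\cdot,\cdot\rangle$, (MJ) $[x,\langle y,z\rangle]+[y,\langle z,x\rangle]+[z,\langle x,y\rangle]+\langle x,[y,z]\rangle+\langle y,[z,x]\rangle+\langle z,[x,y]\rangle=0$; $J_n\subseteq\Theta_n$ is the kernel of the natural surjection $\Theta_n\to\mathscr{Lie}_2(n)$ (equivalently, the submodule generated by all instances of (S1),(S2),(J1),(J2),(MJ) applied at a subtree). An oriented two-colored graph on $X$ is a directed multigraph on vertex set $X$ (not necessarily connected) whose edges are colored red or blue; $\Gamma_n$ is the free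 $R$-module on these. For a tree $T$ and oriented two-colored graph $G$, define $\beta_{G,T}$ from the edges of $G$ to internal vertices of $T$ by sending an edge $i\to j$ to the nadir of the path between leaves $i$ and $j$ in $T$ (the vertex of the path closest to the root, i.e. the lowest common ancestor). Let $N$ be the number of edges $i\to j$ of $G$ for which leaf $i$ lies below the right child and leaf $j$ below the left child of this nadir (the path travels counterclockwise at its nadir), and $\tau_{G,T}=(-1)^N$. Set $\langle\!\langle G,T\rangle\!\rangle=\tau_{G,T}$ if $\beta_{G,T}$ is a bijection and each edge $e$ has the same color as $\beta_{G,T}(e)$, and $0$ otherwise; extend bilinearly to $\Gamma_n\times\Theta_n$. -}

module Defs where

open import Level using (Level; _⊔_)
open import Algebra.Bundles using (CommutativeRing)
open import Data.Bool using (Bool; true; false; if_then_else_; _∧_)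
open import Data.Nat using (ℕ; zero; suc)
open import Data.Nat using () renaming (_≟_ to _≟ℕ_)
open import Data.Fin using (Fin) renaming (_≟_ to _≟F_)
open import Data.List using (List; []; _∷_; _++_; map; allFin; foldr; concatMap; length; filter)
open import Data.List.Properties using (≡-dec)
open import Data.List.Relation.Unary.All using (All)
open import Data.List.Relation.Binary.Permutation.Propositional using (_↭_)
open import Data.Maybe using (Maybe; just; nothing)
open import Data.Product using (_×_; _,_; proj₁; proj₂; Σ; ∃)
open import Relation.Nullary using (Dec; yes; no; does)
open import Relation.Binary.PropositionalEquality using (_≡_; refl; cong)
import Data.Bool as B

data Color : Set where
  red blue : Color

_≟C_ : (a b : Color) → Dec (a ≡ b)
red  ≟C red  = yes refl
red  ≟C blue = no (λ ())
blue ≟C red  = no (λ ())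
blue ≟C blue = yes refl

-- 2v-colored planar binary trees with leaves labelled by X = Fin n
-- (node c l r is the monomial {l , r} with bracket of colour c:
--  red = [_,_], blue = ⟨_,_⟩).

data Tree (n : ℕ) : Set where
  leaf : Fin n → Tree n
  node : Color → Tree n → Tree n → Tree n

leaves : ∀ {n} → Tree n → List (Fin n)
leaves (leaf i)     = i ∷ []
leaves (node _ l r) = leaves l ++ leaves r

Valid : ∀ {n} → Tree n → Set
Valid {n} T = leaves T ↭ allFin n

private
  node-inj : ∀ {n c c' l l' r r'} → node {n} c l r ≡ node c' l' r' →
             (c ≡ c') × (l ≡ l') × (r ≡ r')
  node-inj refl = refl , refl , refl

  leaf-inj : ∀ {n i j} → leaf {n} i ≡ leaf j → i ≡ j
  leaf-inj refl = refl

_≟T_ : ∀ {n} (S T : Tree n) → Dec (S ≡ T)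
leaf i ≟T leaf j with i ≟F j
... | yes refl = yes refl
... | no ne = no (λ e → ne (leaf-inj e))
leaf _ ≟T node _ _ _ = no (λ ())
node _ _ _ ≟T leaf _ = no (λ ())
node c l r ≟T node c' l' r' with c ≟C c' | l ≟T l' | r ≟T r'
... | yes refl | yes refl | yes refl = yes refl
... | no ne | _ | _ = no (λ e → ne (proj₁ (node-inj e)))
... | yes _ | no ne | _ = no (λ e → ne (proj₁ (proj₂ (node-inj e))))
... | yes _ | yes _ | no ne = no (λ e → ne (proj₂ (proj₂ (node-inj e))))

-- One-hole contexts (for "applying a relation at a subtree")

data Ctx (n : ℕ) : Set where
  hole  : Ctx n
  inL   : Color → Ctx n → Tree n → Ctx n
  inR   : Color → Tree n → Ctx n → Ctx n

plug : ∀ {n} → Ctx n → Tree n → Tree n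
plug hole         t = t
plug (inL c C r)  t = node c (plug C t) r
plug (inR c l C)  t = node c l (plug C t)

-- Instances of the defining relations with x, y, z replaced by monomials.
data RelInst (n : ℕ) : Set where
  S1 S2       : Tree n → Tree n → RelInst n
  J1 J2 MJ    : Tree n → Tree n → Tree n → RelInst n

-- the monomials occurring (each with coefficient 1) in a relation instance
relTerms : ∀ {n} → RelInst n → List (Tree n)
relTerms (S1 x y) = node red x y ∷ node red y x ∷ []
relTerms (S2 x y) = node blue x y ∷ node blue y x ∷ []
relTerms (J1 x y z) =
  node red x (node red y z) ∷ node red y (node red z x) ∷ node red z (node red x y) ∷ []
relTerms (J2 x y z) =
  node blue x (node blue y z) ∷ node blue y (node blue z x) ∷ node blue z (node blue x y) ∷ []
relTerms (MJ x y z) =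
  node red x (node blue y z) ∷ node red y (node blue z x) ∷ node red z (node blue x y) ∷
  node blue x (node red y z) ∷ node blue y (node red z x) ∷ node blue z (node red x y) ∷ []

-- A generator of J_n: a relation instance applied at a subtree of a tree on X
record Generator (n : ℕ) : Set where
  field
    ctx   : Ctx n
    rel   : RelInst n
    valid : All Valid (map (plug ctx) (relTerms rel))

genTrees : ∀ {n} → Generator n → List (Tree n)
genTrees g = map (plug (Generator.ctx g)) (relTerms (Generator.rel g))

-- Oriented two-coloured graphs on X (directed multigraphs, edge list)

record Edge (n : ℕ) : Set where
  constructor _⟶_∶_
  field
    src : Fin n
    tgt : Fin n
    col : Color

Graph : ℕ → Set
Graph n = List (Edge n)

-- Addresses of vertices of a tree: paths from the root
-- (false = go to left child, true = go to right child)

Addr : Set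
Addr = List Bool

leafPath : ∀ {n} → Tree n → Fin n → Maybe Addr
leafPath (leaf k) i with k ≟F i
... | yes _ = just []
... | no  _ = nothing
leafPath (node _ l r) i with leafPath l i
... | just p  = just (false ∷ p)
... | nothing = Data.Maybe.map (true ∷_) (leafPath r i)

internalAddrs : ∀ {n} → Tree n → List Addr
internalAddrs (leaf _)     = []
internalAddrs (node _ l r) =
  [] ∷ (map (false ∷_) (internalAddrs l) ++ map (true ∷_) (internalAddrs r))

colorAt : ∀ {n} → Tree n → Addr → Maybe Color
colorAt (leaf _)     _           = nothing
colorAt (node c _ _) []          = just c
colorAt (node _ l _) (false ∷ a) = colorAt l a
colorAt (node _ _ r) (true ∷ a)  = colorAt r a

-- nadir (lowest common ancestor) of the leaves with paths p (source)
-- and q (target), together with whether the path travels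
-- counterclockwise at its nadir (source below right child, target
-- below left child).
nadir : Addr → Addr → Maybe (Addr × Bool)
nadir (false ∷ p) (false ∷ q) = Data.Maybe.map (λ { (a , b) → (false ∷ a , b) }) (nadir p q)
nadir (true ∷ p)  (true ∷ q)  = Data.Maybe.map (λ { (a , b) → (true ∷ a , b) }) (nadir p q)
nadir (false ∷ _) (true ∷ _)  = just ([] , false)
nadir (true ∷ _)  (false ∷ _) = just ([] , true)
nadir _ _ = nothing

-- β_{G,T}(e) together with the counterclockwise flag, provided it is an
-- internal vertex whose colour agrees with the colour of e
edgeInfo : ∀ {n} → Tree n → Edge n → Maybe (Addr × Bool)
edgeInfo T (i ⟶ j ∶ c) with leafPath T i | leafPath T j
... | just p | just q with nadir p q
...   | nothing = nothing
...   | just (a , ccw) with colorAt T a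
...     | nothing = nothing
...     | just c' = if does (c ≟C c') then just (a , ccw) else nothing
edgeInfo T _ | _ | _ = nothing

allInfos : ∀ {n} → Tree n → Graph n → Maybe (List (Addr × Bool))
allInfos T [] = just []
allInfos T (e ∷ es) with edgeInfo T e | allInfos T es
... | just x | just xs = just (x ∷ xs)
... | _      | _       = nothing

countAddr : Addr → List (Addr × Bool) → ℕ
countAddr a xs = length (filter (λ x → ≡-dec B._≟_ (proj₁ x) a) xs)

eachOnce : List Addr → List (Addr × Bool) → Bool
eachOnce []       xs = true
eachOnce (a ∷ as) xs = does (countAddr a xs ≟ℕ 1) ∧ eachOnce as xs

countCCW : List (Addr × Bool) → ℕ
countCCW [] = zero
countCCW ((_ , true) ∷ xs)  = suc (countCCW xs)
countCCW ((_ , false) ∷ xs) = countCCW xs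

module _ {c ℓ : Level} (R : CommutativeRing c ℓ) where
  open CommutativeRing R

  signPow : ℕ → Carrier
  signPow zero    = 1#
  signPow (suc k) = - signPow k

  pairBasis : ∀ {n} → Graph n → Tree n → Carrier
  pairBasis G T with allInfos T G
  ... | nothing = 0#
  ... | just xs = if eachOnce (internalAddrs T) xs then signPow (countCCW xs) else 0#

  -- Elements of the free modules Γ_n and Θ_n as formal linear combinations
  Γ : ℕ → Set c
  Γ n = List (Carrier × Graph n)

  Θ : ℕ → Set c
  Θ n = List (Carrier × Tree n)

  InΘ : ∀ {n} → Θ n → Set c
  InΘ α = All (λ t → Valid (proj₂ t)) α

  pairing : ∀ {n} → Γ n → Θ n → Carrier
  pairing β α = foldr _+_ 0#
    (concatMap (λ g → map (λ t → (proj₁ g * proj₁ t) * pairBasis (proj₂ g) (proj₂ t)) α) β)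

  coeff : ∀ {n} → Θ n → Tree n → Carrier
  coeff [] T = 0#
  coeff ((r , S) ∷ α) T = if does (S ≟T T) then r + coeff α T else coeff α T

  expand : ∀ {n} → List (Carrier × Generator n) → Θ n
  expand = concatMap (λ rg → map (λ S → (proj₁ rg , S)) (genTrees (proj₂ rg)))

  -- α ∈ J_n : α is an R-linear combination of generators (equality in the free module)
  InJ : ∀ {n} → Θ n → Set (c ⊔ ℓ)
  InJ {n} α = ∃ λ (gs : List (Carrier × Generator n)) → (T : Tree n) → coeff α T ≈ coeff (expand gs) T

-- ⟪G, T⟫ factors over the internal vertices of T: at each vertex v exactly one edge of G must have
-- its nadir, and it must have the colour of v; that edge contributes the sign of its orientation,
-- while all other edges are handed down to the two subtrees of v.  Hence plugging the terms of a
-- relation into a context multiplies all their values by one common factor; swapping the arguments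
-- of a bracket reverses the edge at its root, so the two terms of (S1) or (S2) cancel; and the two
-- top vertices of a term of (J1), (J2) or (MJ) need exactly two edges joining the blocks x, y, z.
-- Such a pair of edges leaves either no term or exactly two terms, of opposite signs.  To see this,
-- edges are abstracted to the blocks of their endpoints: edges inside one block are irrelevant, an
-- edge leaving x ∪ y ∪ z kills every term, counting disposes of any number of crossing edges other
-- than two, and the case of two is checked by evaluation.  Values lie in {0, ±1}; a list of them
-- with as many +1 as −1 sums to 0 in every ring, and by linearity the pairing vanishes on J_n.
module Submission where

open import Defs
open import Level using (Level; 0ℓ)
open import Algebra.Bundles using (CommutativeRing; CommutativeSemigroup; CommutativeMonoid)
open import Data.Bool using (Bool; true; false; if_then_else_; _∧_; _∨_; not; T)
open import Data.Bool.Properties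
  using (if-float; if-eta; ∧-assoc; ∨-comm; ∨-commutativeMonoid; T-∧; T-∨; T-≡; ¬-not)
import Data.Bool as Bool
open import Data.Empty using (⊥-elim)
open import Data.Fin using (Fin) renaming (_≟_ to _≟F_)
open import Data.List
  using (List; []; _∷_; _++_; map; foldr; length; filter; filterᵇ; concatMap; cartesianProduct)
open import Data.List.Properties
  using (≡-dec; map-cong; map-cong-local; map-id; map-∘; map-++; length-filter; filter-reject; filter-≐)
open import Data.List.Membership.Propositional using (_∈_; _∉_)
open import Data.List.Membership.Propositional.Properties using (∈-++⁺ˡ; ∈-++⁺ʳ; ∈-cartesianProduct⁺)
open import Data.List.Relation.Unary.All using (All; []; _∷_; all?)
import Data.List.Relation.Unary.All as All
open import Data.List.Relation.Unary.All.Properties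
  using (map⁺; ++⁻ˡ; ++⁻ʳ; filter⁺; all-filter; ¬Any⇒All¬)
open import Data.List.Relation.Unary.Any using (Any; here; there)
import Data.List.Relation.Unary.Any as Any
import Data.List.Relation.Unary.Any.Properties as Any
open import Data.List.Relation.Unary.AllPairs using ([]; _∷_)
open import Data.List.Relation.Unary.Unique.Propositional using (Unique)
open import Data.List.Relation.Unary.Unique.Propositional.Properties using (allFin⁺)
open import Data.List.Relation.Binary.Permutation.Propositional using (↭-sym; ↭⇒↭ₛ)
import Data.List.Relation.Binary.Permutation.Setoid.Properties as Permutation
open import Data.Maybe using (Maybe; just; nothing; is-just; maybe′)
import Data.Maybe as Maybe
open import Data.Nat as ℕ using (ℕ; zero; suc; _≤_; s≤s) renaming (_≟_ to _≟ℕ_)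
import Data.Nat.Properties as ℕₚ
open import Data.Product using (Σ; _×_; _,_; proj₁; proj₂)
open import Data.Sign using (Sign; opposite) renaming (_*_ to _*ˢ_)
import Data.Sign.Properties as Signₚ
open import Data.Sum using (_⊎_; inj₁; inj₂)
open import Data.Unit using (tt)
open import Function using (_∘_; id; Equivalence)
open import Relation.Nullary using (Dec; does; yes; no; ¬_; ¬?)
open import Relation.Nullary.Decidable using (True; T?; _×-dec_; _→-dec_; toWitness)
open import Relation.Unary using (Decidable)
open import Relation.Binary.PropositionalEquality as ≡ using (_≡_; _≢_; _≗_; refl)
import Algebra.Properties.CommutativeSemigroup as CommutativeSemigroupₚ

open Equivalence using (to; from)

filterᵇ-cong : ∀ {A : Set} {p q : A → Bool} → p ≗ q → filterᵇ p ≗ filterᵇ q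
filterᵇ-cong p≗q =
  filter-≐ (T? ∘ _) (T? ∘ _) ((λ {x} → ≡.subst T (p≗q x)) , (λ {x} → ≡.subst T (≡.sym (p≗q x))))

map-filterᵇ : ∀ {A B : Set} (f : A → B) (p : B → Bool) xs → map f (filterᵇ (p ∘ f) xs) ≡ filterᵇ p (map f xs)
map-filterᵇ f p []       = refl
map-filterᵇ f p (x ∷ xs) with p (f x)
... | true  = ≡.cong (f x ∷_) (map-filterᵇ f p xs)
... | false = map-filterᵇ f p xs

filterᵇ-absorb : ∀ {A : Set} {p q : A → Bool} → (∀ x → T (p x) → T (q x)) →
  ∀ xs → filterᵇ p (filterᵇ q xs) ≡ filterᵇ p xs
filterᵇ-absorb p⇒q [] = refl
filterᵇ-absorb {p = p} {q} p⇒q (x ∷ xs) with q x in qx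
... | true with p x
...   | true  = ≡.cong (x ∷_) (filterᵇ-absorb p⇒q xs)
...   | false = filterᵇ-absorb p⇒q xs
filterᵇ-absorb {p = p} {q} p⇒q (x ∷ xs) | false with p x in px
...   | false = filterᵇ-absorb p⇒q xs
...   | true  = ⊥-elim (≡.subst T qx (p⇒q x (≡.subst T (≡.sym px) tt)))

-- Signs with zero

data Val : Set where
  0ᵛ : Val
  ±_ : Sign → Val

infix 8 -ᵛ_
-ᵛ_ : Val → Val
-ᵛ 0ᵛ    = 0ᵛ
-ᵛ (± s) = ± opposite s

infixl 7 _*ᵛ_
_*ᵛ_ : Val → Val → Val
0ᵛ    *ᵛ _     = 0ᵛ
(± _) *ᵛ 0ᵛ    = 0ᵛ
(± s) *ᵛ (± t) = ± (s *ˢ t)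

*ᵛ-zeroʳ : ∀ a → a *ᵛ 0ᵛ ≡ 0ᵛ
*ᵛ-zeroʳ 0ᵛ    = refl
*ᵛ-zeroʳ (± _) = refl

*ᵛ-identityˡ : ∀ a → ± Sign.+ *ᵛ a ≡ a
*ᵛ-identityˡ 0ᵛ    = refl
*ᵛ-identityˡ (± _) = refl

-1*ᵛ : ∀ a → ± Sign.- *ᵛ a ≡ -ᵛ a
-1*ᵛ 0ᵛ    = refl
-1*ᵛ (± _) = refl

*ᵛ-comm : ∀ a b → a *ᵛ b ≡ b *ᵛ a
*ᵛ-comm 0ᵛ    b     = ≡.sym (*ᵛ-zeroʳ b)
*ᵛ-comm (± s) 0ᵛ    = refl
*ᵛ-comm (± s) (± t) = ≡.cong ±_ (Signₚ.*-comm s t)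

*ᵛ-assoc : ∀ a b c → a *ᵛ b *ᵛ c ≡ a *ᵛ (b *ᵛ c)
*ᵛ-assoc 0ᵛ    _     _     = refl
*ᵛ-assoc (± s) 0ᵛ    _     = refl
*ᵛ-assoc (± s) (± t) 0ᵛ    = refl
*ᵛ-assoc (± s) (± t) (± u) = ≡.cong ±_ (Signₚ.*-assoc s t u)

-ᵛ-distribˡ : ∀ a b → -ᵛ a *ᵛ b ≡ -ᵛ (a *ᵛ b)
-ᵛ-distribˡ 0ᵛ         _     = refl
-ᵛ-distribˡ (± _)      0ᵛ    = refl
-ᵛ-distribˡ (± Sign.+) (± t) = refl
-ᵛ-distribˡ (± Sign.-) (± t) = ≡.cong ±_ (≡.sym (Signₚ.opposite-involutive t))

*ᵛ-commutativeSemigroup : CommutativeSemigroup 0ℓ 0ℓ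
*ᵛ-commutativeSemigroup = record
  { _≈_                    = _≡_
  ; _∙_                    = _*ᵛ_
  ; isCommutativeSemigroup = record
    { isSemigroup = record
      { isMagma = record { isEquivalence = ≡.isEquivalence ; ∙-cong = ≡.cong₂ _*ᵛ_ }
      ; assoc   = *ᵛ-assoc
      }
    ; comm        = *ᵛ-comm
    }
  }

open CommutativeSemigroupₚ *ᵛ-commutativeSemigroup using (xy∙z≈xz∙y; xy∙z≈zx∙y; xy∙z≈yz∙x; interchange)

#⁺ #⁻ : List Val → ℕ
#⁺ []              = 0
#⁺ (± Sign.+ ∷ vs) = suc (#⁺ vs)
#⁺ (_ ∷ vs)        = #⁺ vs
#⁻ []              = 0
#⁻ (± Sign.- ∷ vs) = suc (#⁻ vs)
#⁻ (_ ∷ vs)        = #⁻ vs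

Balanced : List Val → Set
Balanced vs = #⁺ vs ≡ #⁻ vs

balanced? : ∀ vs → Dec (Balanced vs)
balanced? vs = #⁺ vs ≟ℕ #⁻ vs

balanced-opposite : ∀ v → Balanced (v ∷ -ᵛ v ∷ [])
balanced-opposite 0ᵛ         = refl
balanced-opposite (± Sign.+) = refl
balanced-opposite (± Sign.-) = refl

balanced-zeros : ∀ {vs} → All (_≡ 0ᵛ) vs → Balanced vs
balanced-zeros []         = refl
balanced-zeros (refl ∷ z) = balanced-zeros z

#⁺-neg : ∀ vs → #⁺ (map -ᵛ_ vs) ≡ #⁻ vs
#⁺-neg []              = refl
#⁺-neg (0ᵛ ∷ vs)       = #⁺-neg vs
#⁺-neg (± Sign.+ ∷ vs) = #⁺-neg vs
#⁺-neg (± Sign.- ∷ vs) = ≡.cong suc (#⁺-neg vs)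

#⁻-neg : ∀ vs → #⁻ (map -ᵛ_ vs) ≡ #⁺ vs
#⁻-neg []              = refl
#⁻-neg (0ᵛ ∷ vs)       = #⁻-neg vs
#⁻-neg (± Sign.+ ∷ vs) = ≡.cong suc (#⁻-neg vs)
#⁻-neg (± Sign.- ∷ vs) = #⁻-neg vs

balanced-*ᵛˡ : ∀ a vs → Balanced vs → Balanced (map (a *ᵛ_) vs)
balanced-*ᵛˡ 0ᵛ         vs _ = balanced-zeros (map⁺ (All.universal (λ _ → refl) vs))
balanced-*ᵛˡ (± Sign.+) vs b rewrite map-cong *ᵛ-identityˡ vs | map-id vs = b
balanced-*ᵛˡ (± Sign.-) vs b rewrite map-cong -1*ᵛ vs =
  ≡.trans (#⁺-neg vs) (≡.trans (≡.sym b) (≡.sym (#⁻-neg vs)))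

sign^ : ℕ → Sign
sign^ zero    = Sign.+
sign^ (suc k) = opposite (sign^ k)

sign^-+ : ∀ m n → sign^ (m ℕ.+ n) ≡ sign^ m *ˢ sign^ n
sign^-+ zero    n = refl
sign^-+ (suc m) n with sign^ m | sign^-+ m n
... | Sign.+ | ih = ≡.cong opposite ih
... | Sign.- | ih = ≡.trans (≡.cong opposite ih) (Signₚ.opposite-involutive (sign^ n))

module _ {n : ℕ} where

  score : Tree n → List (Addr × Bool) → Val
  score T xs = if eachOnce (internalAddrs T) xs then ± sign^ (countCCW xs) else 0ᵛ

  value : Graph n → Tree n → Val
  value G T = maybe′ (score T) 0ᵛ (allInfos T G)

-- Routes of edges and values of vertices

Info : Set
Info = Addr × Bool

descend : Bool → Info → Info
descend d (a , ccw) = d ∷ a , ccw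

data Route : Set where
  inLeft inRight : Route
  across         : Bool → Color → Route
  outside        : Route

isInLeft isInRight isInternal isOutside : Route → Bool
isInLeft inLeft   = true
isInLeft _        = false
isInRight inRight = true
isInRight _       = false
isInternal r      = isInLeft r ∨ isInRight r
isOutside outside = true
isOutside _       = false

-- The route of an edge at a vertex, from the memberships of its source and target in the left and
-- right subtrees; left membership takes precedence, as in leafPath.  In across ccw c, the flag ccw
-- says that the path turns counterclockwise (source on the right), and c is the edge's colour.
routeB : Bool → Bool → Bool → Bool → Color → Route
routeB true  _     true  _     _ = inLeft
routeB true  _     false true  c = across false c
routeB false true  true  _     c = across true c
routeB false true  false true  _ = inRight
routeB _     _     _     _     _ = outside

flipRoute : Route → Route
flipRoute inLeft         = inRight
flipRoute inRight        = inLeft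
flipRoute (across ccw c) = across (not ccw) c
flipRoute outside        = outside

acrossCount : List Route → ℕ
acrossCount []                = 0
acrossCount (across _ _ ∷ rs) = suc (acrossCount rs)
acrossCount (_ ∷ rs)          = acrossCount rs

acrossCount-∷ : ∀ r rs → acrossCount (r ∷ rs) ≡ acrossCount (r ∷ []) ℕ.+ acrossCount rs
acrossCount-∷ inLeft       rs = refl
acrossCount-∷ inRight      rs = refl
acrossCount-∷ (across _ _) rs = refl
acrossCount-∷ outside      rs = refl

orientation : Bool → Sign
orientation false = Sign.+
orientation true  = Sign.-

exactlyOne : List Bool → Val
exactlyOne (ccw ∷ []) = ± orientation ccw
exactlyOne _          = 0ᵛ

-- The orientations of the edges whose nadir is a vertex of colour c, or nothing when some edge
-- leaves the subtree or has its nadir there with the wrong colour; the vertex contributes the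
-- sign of the unique such edge to ⟪G, T⟫.
rootFlags : Color → List Route → Maybe (List Bool)
rootFlags c []                   = just []
rootFlags c (inLeft ∷ rs)        = rootFlags c rs
rootFlags c (inRight ∷ rs)       = rootFlags c rs
rootFlags c (across ccw c′ ∷ rs) = if does (c′ ≟C c) then Maybe.map (ccw ∷_) (rootFlags c rs) else nothing
rootFlags c (outside ∷ rs)       = nothing

rootValue : Color → List Route → Val
rootValue c rs = maybe′ exactlyOne 0ᵛ (rootFlags c rs)

rootFlags-∷ : ∀ c r {rs rs′} → rootFlags c rs ≡ rootFlags c rs′ → rootFlags c (r ∷ rs) ≡ rootFlags c (r ∷ rs′)
rootFlags-∷ c inLeft          eq = eq
rootFlags-∷ c inRight         eq = eq
rootFlags-∷ c (across ccw c′) eq = ≡.cong (λ F → if does (c′ ≟C c) then Maybe.map (ccw ∷_) F else nothing) eq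
rootFlags-∷ c outside         _  = refl

rootFlags-internal : ∀ c r rs → T (isInternal r) → rootFlags c (r ∷ rs) ≡ rootFlags c rs
rootFlags-internal c inLeft  rs _ = refl
rootFlags-internal c inRight rs _ = refl

rootFlags-outside : ∀ c {rs} → Any (T ∘ isOutside) rs → rootFlags c rs ≡ nothing
rootFlags-outside c {outside ∷ _} (here _)    = refl
rootFlags-outside c {r ∷ rs}      (there out) = absorb r (rootFlags-outside c out)
  where
  absorb : ∀ r → rootFlags c rs ≡ nothing → rootFlags c (r ∷ rs) ≡ nothing
  absorb inLeft          rs↯ = rs↯
  absorb inRight         rs↯ = rs↯
  absorb (across ccw c′) rs↯ rewrite rs↯ = if-eta (does (c′ ≟C c))
  absorb outside         _   = refl

rootFlags-length : ∀ c rs {bs} → rootFlags c rs ≡ just bs → acrossCount rs ≡ length bs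
rootFlags-length c []                   refl = refl
rootFlags-length c (inLeft ∷ rs)        eq   = rootFlags-length c rs eq
rootFlags-length c (inRight ∷ rs)       eq   = rootFlags-length c rs eq
rootFlags-length c (across ccw c′ ∷ rs) eq with does (c′ ≟C c) | rootFlags c rs in flags
rootFlags-length c (across ccw c′ ∷ rs) refl | true  | just bs = ≡.cong suc (rootFlags-length c rs flags)
rootFlags-length c (across ccw c′ ∷ rs) ()   | true  | nothing
rootFlags-length c (across ccw c′ ∷ rs) ()   | false | _
rootFlags-length c (outside ∷ rs)       ()

rootValue-nonzero : ∀ c rs {s} → rootValue c rs ≡ ± s → acrossCount rs ≡ 1
rootValue-nonzero c rs eq with rootFlags c rs in flags
rootValue-nonzero c rs eq | just (_ ∷ [])     = rootFlags-length c rs flags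
rootValue-nonzero c rs () | just []
rootValue-nonzero c rs () | just (_ ∷ _ ∷ _)
rootValue-nonzero c rs () | nothing

rootFlags-flip : ∀ c rs → rootFlags c (map flipRoute rs) ≡ Maybe.map (map not) (rootFlags c rs)
rootFlags-flip c []                   = refl
rootFlags-flip c (inLeft ∷ rs)        = rootFlags-flip c rs
rootFlags-flip c (inRight ∷ rs)       = rootFlags-flip c rs
rootFlags-flip c (outside ∷ rs)       = refl
rootFlags-flip c (across ccw c′ ∷ rs) with does (c′ ≟C c)
... | false = refl
... | true rewrite rootFlags-flip c rs with rootFlags c rs
...   | just _  = refl
...   | nothing = refl

exactlyOne-not : ∀ bs → exactlyOne (map not bs) ≡ -ᵛ exactlyOne bs
exactlyOne-not []           = refl
exactlyOne-not (false ∷ []) = refl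
exactlyOne-not (true ∷ [])  = refl
exactlyOne-not (_ ∷ _ ∷ _)  = refl

rootValue-flip : ∀ c rs → rootValue c (map flipRoute rs) ≡ -ᵛ rootValue c rs
rootValue-flip c rs rewrite rootFlags-flip c rs with rootFlags c rs
... | just bs = exactlyOne-not bs
... | nothing = refl

module _ {A : Set} (c : Color) (f : A → Route) where

  rootFlags-filterᵇ : ∀ p l → rootFlags c (map f (filterᵇ p l)) ≡ rootFlags c (map (λ a → if p a then f a else inLeft) l)
  rootFlags-filterᵇ p []      = refl
  rootFlags-filterᵇ p (a ∷ l) with p a
  ... | true  = rootFlags-∷ c (f a) (rootFlags-filterᵇ p l)
  ... | false = rootFlags-filterᵇ p l

  rootFlags-drop : ∀ p → (∀ a → T (p a) → T (isInternal (f a))) →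
    ∀ l → rootFlags c (map f (filterᵇ (not ∘ p) l)) ≡ rootFlags c (map f l)
  rootFlags-drop p internal [] = refl
  rootFlags-drop p internal (a ∷ l) with p a in pa
  ... | false = rootFlags-∷ c (f a) (rootFlags-drop p internal l)
  ... | true  = ≡.trans (rootFlags-drop p internal l)
                        (≡.sym (rootFlags-internal c (f a) _ (internal a (≡.subst T (≡.sym pa) tt))))

-- Factorization at a vertex

atRoot : List Info → List Bool
atRoot []                = []
atRoot (([] , ccw) ∷ xs) = ccw ∷ atRoot xs
atRoot (_ ∷ xs)          = atRoot xs

below : Bool → List Info → List Info
below d []                    = []
below d (([] , _) ∷ xs)       = below d xs
below d ((d′ ∷ a , ccw) ∷ xs) = if does (d′ Bool.≟ d) then (a , ccw) ∷ below d xs else below d xs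

data NodeSplit (F : Maybe (List Bool)) (IL IR : Maybe (List Info)) : Maybe (List Info) → Set where
  split-nothing : F ≡ nothing ⊎ IL ≡ nothing ⊎ IR ≡ nothing → NodeSplit F IL IR nothing
  split-just    : ∀ xs → F ≡ just (atRoot xs) → IL ≡ just (below false xs) → IR ≡ just (below true xs) →
                  NodeSplit F IL IR (just xs)

private
  split-left : ∀ x {F IL IR I} → NodeSplit F IL IR I →
    NodeSplit F (Maybe.zipWith _∷_ x IL) IR (Maybe.zipWith _∷_ (Maybe.map (descend false) x) I)
  split-left nothing  _                                  = split-nothing (inj₂ (inj₁ refl))
  split-left (just _) (split-nothing (inj₁ F≡∅))         = split-nothing (inj₁ F≡∅)
  split-left (just _) (split-nothing (inj₂ (inj₁ refl))) = split-nothing (inj₂ (inj₁ refl))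
  split-left (just _) (split-nothing (inj₂ (inj₂ IR≡∅))) = split-nothing (inj₂ (inj₂ IR≡∅))
  split-left (just x) (split-just xs F≡ refl IR≡)        = split-just (descend false x ∷ xs) F≡ refl IR≡

  split-right : ∀ x {F IL IR I} → NodeSplit F IL IR I →
    NodeSplit F IL (Maybe.zipWith _∷_ x IR) (Maybe.zipWith _∷_ (Maybe.map (descend true) x) I)
  split-right nothing  _                                  = split-nothing (inj₂ (inj₂ refl))
  split-right (just _) (split-nothing (inj₁ F≡∅))         = split-nothing (inj₁ F≡∅)
  split-right (just _) (split-nothing (inj₂ (inj₁ IL≡∅))) = split-nothing (inj₂ (inj₁ IL≡∅))
  split-right (just _) (split-nothing (inj₂ (inj₂ refl))) = split-nothing (inj₂ (inj₂ refl))
  split-right (just x) (split-just xs F≡ IL≡ refl)        = split-just (descend true x ∷ xs) F≡ IL≡ refl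

  split-root : ∀ ccw {F IL IR I} → NodeSplit F IL IR I →
    NodeSplit (Maybe.map (ccw ∷_) F) IL IR (Maybe.zipWith _∷_ (just ([] , ccw)) I)
  split-root ccw (split-nothing (inj₁ refl))  = split-nothing (inj₁ refl)
  split-root ccw (split-nothing (inj₂ IL|IR)) = split-nothing (inj₂ IL|IR)
  split-root ccw (split-just xs refl IL≡ IR≡) = split-just (([] , ccw) ∷ xs) refl IL≡ IR≡

module _ {n : ℕ} where

  memT : Tree n → Fin n → Bool
  memT T i = is-just (leafPath T i)

  memT-node : ∀ c (L R : Tree n) i → memT (node c L R) i ≡ memT L i ∨ memT R i
  memT-node c L R i with leafPath L i
  ... | just _  = refl
  ... | nothing with leafPath R i
  ...   | just _  = refl
  ...   | nothing = refl

  route : (Fin n → Bool) → (Fin n → Bool) → Edge n → Route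
  route mL mR (i ⟶ j ∶ c) = routeB (mL i) (mR i) (mL j) (mR j) c

  route-cong : ∀ {mL mL′ mR mR′ : Fin n → Bool} → mL ≗ mL′ → mR ≗ mR′ → route mL mR ≗ route mL′ mR′
  route-cong mL≗ mR≗ (i ⟶ j ∶ c) rewrite mL≗ i | mR≗ i | mL≗ j | mR≗ j = refl

  leftEdges rightEdges : (Fin n → Bool) → (Fin n → Bool) → Graph n → Graph n
  leftEdges  mL mR = filterᵇ (λ e → isInLeft (route mL mR e))
  rightEdges mL mR = filterᵇ (λ e → isInRight (route mL mR e))

  routeInfo : Color → Route → Maybe Info → Maybe Info → Maybe Info
  routeInfo _ inLeft          l _ = Maybe.map (descend false) l
  routeInfo _ inRight         _ r = Maybe.map (descend true) r
  routeInfo c (across ccw c′) _ _ = if does (c′ ≟C c) then just ([] , ccw) else nothing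
  routeInfo _ outside         _ _ = nothing

  edgeInfo-node : ∀ c (L R : Tree n) e →
    edgeInfo (node c L R) e ≡ routeInfo c (route (memT L) (memT R) e) (edgeInfo L e) (edgeInfo R e)
  edgeInfo-node c L R (i ⟶ j ∶ col) with leafPath L i | leafPath L j
  edgeInfo-node c L R (i ⟶ j ∶ col) | just p | just q with nadir p q
  ... | nothing = refl
  ... | just (a , ccw) with colorAt L a
  ...   | nothing = refl
  ...   | just c′ = ≡.sym (if-float (Maybe.map (descend false)) (does (col ≟C c′)))
  edgeInfo-node c L R (i ⟶ j ∶ col) | just p | nothing with leafPath R j
  ... | just _  = refl
  ... | nothing = refl
  edgeInfo-node c L R (i ⟶ j ∶ col) | nothing | lj with leafPath R i
  ... | nothing = refl
  ... | just p with lj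
  ...   | just _  = refl
  ...   | nothing with leafPath R j
  ...     | nothing = refl
  ...     | just q with nadir p q
  ...       | nothing = refl
  ...       | just (a , ccw) with colorAt R a
  ...         | nothing = refl
  ...         | just c′ = ≡.sym (if-float (Maybe.map (descend true)) (does (col ≟C c′)))

  allInfos-∷ : ∀ (T : Tree n) e G → allInfos T (e ∷ G) ≡ Maybe.zipWith _∷_ (edgeInfo T e) (allInfos T G)
  allInfos-∷ T e G with edgeInfo T e | allInfos T G
  ... | just _  | just _  = refl
  ... | just _  | nothing = refl
  ... | nothing | _       = refl

  allInfos-node : ∀ c (L R : Tree n) G →
    NodeSplit (rootFlags c (map (route (memT L) (memT R)) G)) (allInfos L (leftEdges (memT L) (memT R) G))
              (allInfos R (rightEdges (memT L) (memT R) G)) (allInfos (node c L R) G)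
  allInfos-node c L R [] = split-just [] refl refl refl
  allInfos-node c L R (e ∷ G)
    rewrite allInfos-∷ (node c L R) e G | edgeInfo-node c L R e
    with route (memT L) (memT R) e | allInfos-node c L R G
  ... | inLeft  | ih rewrite allInfos-∷ L e (leftEdges (memT L) (memT R) G) = split-left (edgeInfo L e) ih
  ... | inRight | ih rewrite allInfos-∷ R e (rightEdges (memT L) (memT R) G) = split-right (edgeInfo R e) ih
  ... | outside | _  = split-nothing (inj₁ refl)
  ... | across ccw c′ | ih with does (c′ ≟C c)
  ...   | true  = split-root ccw ih
  ...   | false = split-nothing (inj₁ refl)

countAddr-[] : ∀ xs → countAddr [] xs ≡ length (atRoot xs)
countAddr-[] []                 = refl
countAddr-[] (([] , _) ∷ xs)    = ≡.cong suc (countAddr-[] xs)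
countAddr-[] ((_ ∷ _ , _) ∷ xs) = countAddr-[] xs

countAddr-below : ∀ d a xs → countAddr (d ∷ a) xs ≡ countAddr a (below d xs)
countAddr-below d a []                   = refl
countAddr-below d a (([] , _) ∷ xs)      = countAddr-below d a xs
countAddr-below d a ((d′ ∷ a′ , _) ∷ xs) with d′ Bool.≟ d
... | no _     = countAddr-below d a xs
... | yes refl with does (≡-dec Bool._≟_ a′ a)
...   | true  = ≡.cong suc (countAddr-below d a xs)
...   | false = countAddr-below d a xs

eachOnce-++ : ∀ as bs xs → eachOnce (as ++ bs) xs ≡ eachOnce as xs ∧ eachOnce bs xs
eachOnce-++ []       bs xs = refl
eachOnce-++ (a ∷ as) bs xs =
  ≡.trans (≡.cong (does (countAddr a xs ≟ℕ 1) ∧_) (eachOnce-++ as bs xs))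
          (≡.sym (∧-assoc (does (countAddr a xs ≟ℕ 1)) _ _))

eachOnce-below : ∀ d as xs → eachOnce (map (d ∷_) as) xs ≡ eachOnce as (below d xs)
eachOnce-below d []       xs = refl
eachOnce-below d (a ∷ as) xs =
  ≡.cong₂ (λ k b → does (k ≟ℕ 1) ∧ b) (countAddr-below d a xs) (eachOnce-below d as xs)

countCCW-split : ∀ xs →
  countCCW xs ≡ length (filterᵇ id (atRoot xs)) ℕ.+ (countCCW (below false xs) ℕ.+ countCCW (below true xs))
countCCW-split []                         = refl
countCCW-split (([] , true) ∷ xs)         = ≡.cong suc (countCCW-split xs)
countCCW-split (([] , false) ∷ xs)        = countCCW-split xs
countCCW-split ((false ∷ _ , false) ∷ xs) = countCCW-split xs
countCCW-split ((true ∷ _ , false) ∷ xs)  = countCCW-split xs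
countCCW-split ((false ∷ _ , true) ∷ xs)  =
  ≡.trans (≡.cong suc (countCCW-split xs)) (≡.sym (ℕₚ.+-suc (length (filterᵇ id (atRoot xs))) _))
countCCW-split ((true ∷ _ , true) ∷ xs)   =
  ≡.trans (≡.cong suc (countCCW-split xs))
    (≡.trans (≡.sym (ℕₚ.+-suc (length (filterᵇ id (atRoot xs))) _))
             (≡.cong (length (filterᵇ id (atRoot xs)) ℕ.+_) (≡.sym (ℕₚ.+-suc (countCCW (below false xs)) _))))

private
  sign^-orientation : ∀ ccw → sign^ (length (filterᵇ id (ccw ∷ []))) ≡ orientation ccw
  sign^-orientation false = refl
  sign^-orientation true  = refl

  split-sign : ∀ bs eL eR kL kR →
    (if does (length bs ≟ℕ 1) ∧ (eL ∧ eR) then ± sign^ (length (filterᵇ id bs) ℕ.+ (kL ℕ.+ kR)) else 0ᵛ)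
    ≡ exactlyOne bs *ᵛ (if eL then ± sign^ kL else 0ᵛ) *ᵛ (if eR then ± sign^ kR else 0ᵛ)
  split-sign []          _     _     _  _  = refl
  split-sign (_ ∷ _ ∷ _) _     _     _  _  = refl
  split-sign (_ ∷ [])    false _     _  _  = refl
  split-sign (_ ∷ [])    true  false _  _  = refl
  split-sign (ccw ∷ [])  true  true  kL kR = ≡.cong ±_ (begin
    sign^ (k ℕ.+ (kL ℕ.+ kR))               ≡⟨ sign^-+ k (kL ℕ.+ kR) ⟩
    sign^ k *ˢ sign^ (kL ℕ.+ kR)            ≡⟨ ≡.cong (sign^ k *ˢ_) (sign^-+ kL kR) ⟩
    sign^ k *ˢ (sign^ kL *ˢ sign^ kR)       ≡⟨ Signₚ.*-assoc (sign^ k) _ _ ⟨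
    sign^ k *ˢ sign^ kL *ˢ sign^ kR         ≡⟨ ≡.cong (λ s → s *ˢ sign^ kL *ˢ sign^ kR) (sign^-orientation ccw) ⟩
    orientation ccw *ˢ sign^ kL *ˢ sign^ kR ∎)
    where
    open ≡.≡-Reasoning
    k : ℕ
    k = length (filterᵇ id (ccw ∷ []))

score-node : ∀ {n} c (L R : Tree n) xs →
  score (node c L R) xs ≡ exactlyOne (atRoot xs) *ᵛ score L (below false xs) *ᵛ score R (below true xs)
score-node c L R xs
  rewrite countAddr-[] xs
        | eachOnce-++ (map (false ∷_) (internalAddrs L)) (map (true ∷_) (internalAddrs R)) xs
        | eachOnce-below false (internalAddrs L) xs
        | eachOnce-below true (internalAddrs R) xs
        | countCCW-split xs
  = split-sign (atRoot xs) (eachOnce (internalAddrs L) (below false xs)) (eachOnce (internalAddrs R) (below true xs))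
               (countCCW (below false xs)) (countCCW (below true xs))

module _ {n : ℕ} where

  value-node : ∀ c (L R : Tree n) G →
    value G (node c L R)
    ≡ rootValue c (map (route (memT L) (memT R)) G) *ᵛ value (leftEdges (memT L) (memT R) G) L
                                                    *ᵛ value (rightEdges (memT L) (memT R) G) R
  value-node c L R G with allInfos (node c L R) G | allInfos-node c L R G
  ... | nothing | split-nothing (inj₁ F≡∅)         rewrite F≡∅  = refl
  ... | nothing | split-nothing (inj₂ (inj₁ IL≡∅)) rewrite IL≡∅ = ≡.cong (_*ᵛ _) (≡.sym (*ᵛ-zeroʳ _))
  ... | nothing | split-nothing (inj₂ (inj₂ IR≡∅)) rewrite IR≡∅ = ≡.sym (*ᵛ-zeroʳ _)
  ... | just xs | split-just xs F≡ IL≡ IR≡ rewrite F≡ | IL≡ | IR≡ = score-node c L R xs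

module _ {n : ℕ} where

  value-node-≗ : ∀ c {L R : Tree n} {mL mR} → memT L ≗ mL → memT R ≗ mR → ∀ G →
    value G (node c L R) ≡ rootValue c (map (route mL mR) G) *ᵛ value (leftEdges mL mR G) L *ᵛ value (rightEdges mL mR G) R
  value-node-≗ c {L} {R} {mL} {mR} L≗ R≗ G = ≡.trans (value-node c L R G)
    (≡.cong₂ _*ᵛ_
      (≡.cong₂ _*ᵛ_ (≡.cong (rootValue c) (map-cong routes≗ G))
                    (≡.cong (λ H → value H L) (filterᵇ-cong (λ e → ≡.cong isInLeft (routes≗ e)) G)))
      (≡.cong (λ H → value H R) (filterᵇ-cong (λ e → ≡.cong isInRight (routes≗ e)) G)))
    where
    routes≗ : route (memT L) (memT R) ≗ route mL mR
    routes≗ = route-cong L≗ R≗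

-- Contexts

module _ {n : ℕ} where

  memC : Ctx n → (Fin n → Bool) → Fin n → Bool
  memC hole        m   = m
  memC (inL _ C r) m i = memC C m i ∨ memT r i
  memC (inR _ l C) m i = memT l i ∨ memC C m i

  memT-plug : ∀ C {t : Tree n} {m} → memT t ≗ m → memT (plug C t) ≗ memC C m
  memT-plug hole        t≗m i = t≗m i
  memT-plug (inL c C r) {t} t≗m i = ≡.trans (memT-node c (plug C t) r i) (≡.cong (_∨ memT r i) (memT-plug C t≗m i))
  memT-plug (inR c l C) {t} t≗m i = ≡.trans (memT-node c l (plug C t) i) (≡.cong (memT l i ∨_) (memT-plug C t≗m i))

  value-plug : ∀ (C : Ctx n) m G → Σ (Val × Graph n) λ (κ , G′) →
    ∀ t → memT t ≗ m → value G (plug C t) ≡ κ *ᵛ value G′ t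
  value-plug hole m G = (± Sign.+ , G) , λ t _ → ≡.sym (*ᵛ-identityˡ (value G t))
  value-plug (inL c C r) m G =
    let mC = memC C m ; mr = memT r
        ((κ , G′) , plugged) = value-plug C m (leftEdges mC mr G)
        a = rootValue c (map (route mC mr) G) ; b = value (rightEdges mC mr G) r
    in (a *ᵛ κ *ᵛ b , G′) , λ t t≗m → begin
      value G (node c (plug C t) r)                  ≡⟨ value-node-≗ c (memT-plug C t≗m) (λ _ → refl) G ⟩
      a *ᵛ value (leftEdges mC mr G) (plug C t) *ᵛ b ≡⟨ ≡.cong (λ v → a *ᵛ v *ᵛ b) (plugged t t≗m) ⟩
      a *ᵛ (κ *ᵛ value G′ t) *ᵛ b                    ≡⟨ ≡.cong (_*ᵛ b) (*ᵛ-assoc a κ _) ⟨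
      a *ᵛ κ *ᵛ value G′ t *ᵛ b                      ≡⟨ xy∙z≈xz∙y (a *ᵛ κ) _ b ⟩
      a *ᵛ κ *ᵛ b *ᵛ value G′ t                      ∎
    where open ≡.≡-Reasoning
  value-plug (inR c l C) m G =
    let mC = memC C m ; ml = memT l
        ((κ , G′) , plugged) = value-plug C m (rightEdges ml mC G)
        a = rootValue c (map (route ml mC) G) ; b = value (leftEdges ml mC G) l
    in (a *ᵛ b *ᵛ κ , G′) , λ t t≗m → begin
      value G (node c l (plug C t))                  ≡⟨ value-node-≗ c (λ _ → refl) (memT-plug C t≗m) G ⟩
      a *ᵛ b *ᵛ value (rightEdges ml mC G) (plug C t) ≡⟨ ≡.cong (a *ᵛ b *ᵛ_) (plugged t t≗m) ⟩
      a *ᵛ b *ᵛ (κ *ᵛ value G′ t)                    ≡⟨ *ᵛ-assoc (a *ᵛ b) κ _ ⟨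
      a *ᵛ b *ᵛ κ *ᵛ value G′ t                      ∎
    where open ≡.≡-Reasoning

  balanced-plug : ∀ (C : Ctx n) ts m → All (λ t → memT t ≗ m) ts → (∀ G → Balanced (map (value G) ts)) →
    ∀ G → Balanced (map (value G) (map (plug C) ts))
  balanced-plug C ts m ts≗m balanced G =
    let ((κ , G′) , plugged) = value-plug C m G in
    ≡.subst Balanced
      (≡.sym (begin
        map (value G) (map (plug C) ts) ≡⟨ map-∘ ts ⟨
        map (value G ∘ plug C) ts       ≡⟨ map-cong-local (All.map (λ {t} → plugged t) ts≗m) ⟩
        map ((κ *ᵛ_) ∘ value G′) ts     ≡⟨ map-∘ ts ⟩
        map (κ *ᵛ_) (map (value G′) ts) ∎))
      (balanced-*ᵛˡ κ (map (value G′) ts) (balanced G′))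
    where open ≡.≡-Reasoning

-- Disjoint subtrees and antisymmetry

module _ {n : ℕ} where

  Disjoint : Tree n → Tree n → Set
  Disjoint S U = ∀ i → T (memT S i) → ¬ T (memT U i)

  Disjoint-sym : ∀ {S U : Tree n} → Disjoint S U → Disjoint U S
  Disjoint-sym S#U i u s = S#U i s u

  Disjoint-node : ∀ c (S V W : Tree n) → Disjoint S V → Disjoint S W → Disjoint S (node c V W)
  Disjoint-node c S V W S#V S#W i s v∨w with to T-∨ (≡.subst T (memT-node c V W i) v∨w)
  ... | inj₁ v = S#V i s v
  ... | inj₂ w = S#W i s w

  within : (Fin n → Bool) → Edge n → Bool
  within m (i ⟶ j ∶ _) = m i ∧ m j

  infixl 5 _↾_
  _↾_ : Graph n → Tree n → Graph n
  G ↾ S = filterᵇ (within (memT S)) G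

private
  isInLeft-routeB : ∀ a b c d col → isInLeft (routeB a b c d col) ≡ a ∧ c
  isInLeft-routeB true  _     true  _     _ = refl
  isInLeft-routeB true  _     false true  _ = refl
  isInLeft-routeB true  _     false false _ = refl
  isInLeft-routeB false true  true  _     _ = refl
  isInLeft-routeB false true  false true  _ = refl
  isInLeft-routeB false true  false false _ = refl
  isInLeft-routeB false false _     _     _ = refl

  isInRight-routeB : ∀ a b c d col → (T a → ¬ T b) → (T c → ¬ T d) → isInRight (routeB a b c d col) ≡ b ∧ d
  isInRight-routeB true  true  _     _     _ a#b _   = ⊥-elim (a#b tt tt)
  isInRight-routeB _     _     true  true  _ _   c#d = ⊥-elim (c#d tt tt)
  isInRight-routeB true  false true  false _ _ _ = refl
  isInRight-routeB true  false false true  _ _ _ = refl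
  isInRight-routeB true  false false false _ _ _ = refl
  isInRight-routeB false true  true  false _ _ _ = refl
  isInRight-routeB false true  false true  _ _ _ = refl
  isInRight-routeB false true  false false _ _ _ = refl
  isInRight-routeB false false true  false _ _ _ = refl
  isInRight-routeB false false false true  _ _ _ = refl
  isInRight-routeB false false false false _ _ _ = refl

  routeB-swap : ∀ a b c d col → (T a → ¬ T b) → (T c → ¬ T d) → routeB b a d c col ≡ flipRoute (routeB a b c d col)
  routeB-swap true  true  _     _     _ a#b _   = ⊥-elim (a#b tt tt)
  routeB-swap _     _     true  true  _ _   c#d = ⊥-elim (c#d tt tt)
  routeB-swap true  false true  false _ _ _ = refl
  routeB-swap true  false false true  _ _ _ = refl
  routeB-swap true  false false false _ _ _ = refl
  routeB-swap false true  true  false _ _ _ = refl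
  routeB-swap false true  false true  _ _ _ = refl
  routeB-swap false true  false false _ _ _ = refl
  routeB-swap false false true  false _ _ _ = refl
  routeB-swap false false false true  _ _ _ = refl
  routeB-swap false false false false _ _ _ = refl

module _ {n : ℕ} where

  leftEdges-↾ : ∀ (L : Tree n) mR G → leftEdges (memT L) mR G ≡ G ↾ L
  leftEdges-↾ L mR = filterᵇ-cong {q = within (memT L)}
    (λ (i ⟶ j ∶ col) → isInLeft-routeB (memT L i) (mR i) (memT L j) (mR j) col)

  rightEdges-↾ : ∀ (L R : Tree n) → Disjoint L R → ∀ G → rightEdges (memT L) (memT R) G ≡ G ↾ R
  rightEdges-↾ L R L#R = filterᵇ-cong {q = within (memT R)}
    (λ (i ⟶ j ∶ col) → isInRight-routeB (memT L i) (memT R i) (memT L j) (memT R j) col (L#R i) (L#R j))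

  route-swap : ∀ (L R : Tree n) → Disjoint L R → route (memT R) (memT L) ≗ flipRoute ∘ route (memT L) (memT R)
  route-swap L R L#R (i ⟶ j ∶ col) = routeB-swap (memT L i) (memT R i) (memT L j) (memT R j) col (L#R i) (L#R j)

  value-node-disjoint : ∀ c (L R : Tree n) → Disjoint L R → ∀ G →
    value G (node c L R) ≡ rootValue c (map (route (memT L) (memT R)) G) *ᵛ value (G ↾ L) L *ᵛ value (G ↾ R) R
  value-node-disjoint c L R L#R G = ≡.trans (value-node c L R G)
    (≡.cong₂ (λ GL GR → rootValue c (map (route (memT L) (memT R)) G) *ᵛ value GL L *ᵛ value GR R)
      (leftEdges-↾ L (memT R) G) (rightEdges-↾ L R L#R G))

  value-swap : ∀ c (x y : Tree n) → Disjoint x y → ∀ G → value G (node c y x) ≡ -ᵛ value G (node c x y)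
  value-swap c x y x#y G = begin
    value G (node c y x)
      ≡⟨ value-node-disjoint c y x (Disjoint-sym {S = x} {U = y} x#y) G ⟩
    rootValue c (map (route (memT y) (memT x)) G) *ᵛ Py *ᵛ Px
      ≡⟨ ≡.cong (λ rs → rootValue c rs *ᵛ Py *ᵛ Px) routes ⟩
    rootValue c (map flipRoute rs) *ᵛ Py *ᵛ Px                ≡⟨ ≡.cong (λ a → a *ᵛ Py *ᵛ Px) (rootValue-flip c rs) ⟩
    -ᵛ a *ᵛ Py *ᵛ Px                                          ≡⟨ ≡.cong (_*ᵛ Px) (-ᵛ-distribˡ a Py) ⟩
    -ᵛ (a *ᵛ Py) *ᵛ Px                                        ≡⟨ -ᵛ-distribˡ (a *ᵛ Py) Px ⟩
    -ᵛ (a *ᵛ Py *ᵛ Px)                                        ≡⟨ ≡.cong -ᵛ_ (xy∙z≈xz∙y a Py Px) ⟩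
    -ᵛ (a *ᵛ Px *ᵛ Py)                                        ≡⟨ ≡.cong -ᵛ_ (value-node-disjoint c x y x#y G) ⟨
    -ᵛ value G (node c x y)                                   ∎
    where
    open ≡.≡-Reasoning
    rs : List Route
    rs = map (route (memT x) (memT y)) G
    a Px Py : Val
    a  = rootValue c rs
    Px = value (G ↾ x) x
    Py = value (G ↾ y) y
    routes : map (route (memT y) (memT x)) G ≡ map flipRoute rs
    routes = ≡.trans (map-cong (route-swap x y x#y) G) (map-∘ G)

  antisymmetry-balanced : ∀ c (x y : Tree n) → Disjoint x y →
    ∀ G → Balanced (map (value G) (node c x y ∷ node c y x ∷ []))
  antisymmetry-balanced c x y x#y G rewrite value-swap c x y x#y G = balanced-opposite (value G (node c x y))

-- Jacobi-type sums on abstract edges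

-- The implicit argument is the decision procedure's verdict; when it evaluates to true it is solved
-- by tt, so an instance is proved by running the check over the whole finite list.
exhaustively : ∀ {A : Set} {Q : A → Set} (xs : List A) → (∀ a → a ∈ xs) → (Q? : Decidable Q) →
  {True (all? Q? xs)} → ∀ a → Q a
exhaustively xs complete Q? {ok} a = All.lookup (toWitness {a? = all? Q? xs} ok) (complete a)

data Block : Set where
  X Y Z other : Block

is : Block → Block → Bool
is X     X     = true
is Y     Y     = true
is Z     Z     = true
is other other = true
is _     _     = false

allBlocks : List Block
allBlocks = X ∷ Y ∷ Z ∷ other ∷ []

-- An edge seen only through the blocks containing its source and target, and its colour.
Letter : Set
Letter = Block × Block × Color

allLetters : List Letter
allLetters = cartesianProduct allBlocks (cartesianProduct allBlocks (red ∷ blue ∷ []))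

∈-allLetters : ∀ a → a ∈ allLetters
∈-allLetters (s , t , c) = ∈-cartesianProduct⁺ (∈-allBlocks s) (∈-cartesianProduct⁺ (∈-allBlocks t) (∈-colours c))
  where
  ∈-allBlocks : ∀ b → b ∈ allBlocks
  ∈-allBlocks X     = here refl
  ∈-allBlocks Y     = there (here refl)
  ∈-allBlocks Z     = there (there (here refl))
  ∈-allBlocks other = there (there (there (here refl)))
  ∈-colours : ∀ c → c ∈ red ∷ blue ∷ []
  ∈-colours red  = here refl
  ∈-colours blue = there (here refl)

data Rotation : Set where
  xyz yzx zxy : Rotation

allRotations : List Rotation
allRotations = xyz ∷ yzx ∷ zxy ∷ []

rotate : ∀ {A : Set} → Rotation → A → A → A → A × A × A
rotate xyz a b c = a , b , c
rotate yzx a b c = b , c , a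
rotate zxy a b c = c , a , b

rotationsAndLetters : List (Rotation × Letter)
rotationsAndLetters = cartesianProduct allRotations allLetters

∈-rotationsAndLetters : ∀ ra → ra ∈ rotationsAndLetters
∈-rotationsAndLetters (r , a) = ∈-cartesianProduct⁺ (∈-allRotations r) (∈-allLetters a)
  where
  ∈-allRotations : ∀ r → r ∈ allRotations
  ∈-allRotations xyz = here refl
  ∈-allRotations yzx = there (here refl)
  ∈-allRotations zxy = there (there (here refl))

data Shape : Set where
  shape : (outer inner : Color) → Rotation → Shape

routeᴸ : (Block → Bool) → (Block → Bool) → Letter → Route
routeᴸ p q (s , t , c) = routeB (p s) (q s) (p t) (q t) c

insideᴸ : (Block → Bool) → Letter → Bool
insideᴸ p (s , t , _) = p s ∧ p t

-- For the term node c₁ u (node c₂ v w) with (u , v , w) = rotate r x y z: the routes of letters at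
-- its two top vertices.  Letters not inside v ∪ w never reach the inner vertex; routing them inLeft
-- makes them invisible to rootFlags there.
outerRoute innerRoute : Rotation → Letter → Route
outerRoute r = let (u , v , w) = rotate r X Y Z in routeᴸ (is u) (λ b → is v b ∨ is w b)
innerRoute r a = let (u , v , w) = rotate r X Y Z in
  if insideᴸ (λ b → is v b ∨ is w b) a then routeᴸ (is v) (is w) a else inLeft

topValue : Shape → List Letter → Val
topValue (shape c₁ c₂ r) l = rootValue c₁ (map (outerRoute r) l) *ᵛ rootValue c₂ (map (innerRoute r) l)

touchesOther neutral : Letter → Bool
touchesOther (s , t , _) = is other s ∨ is other t
neutral      (s , t , _) = is s t ∧ not (is other s)

Crossing : Letter → Set
Crossing a = ¬ T (touchesOther a) × T (not (neutral a))

outer-touchesOther : ∀ r a → T (touchesOther a) → T (isOutside (outerRoute r a))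
outer-touchesOther r a = exhaustively rotationsAndLetters ∈-rotationsAndLetters
  (λ (r , a) → T? (touchesOther a) →-dec T? (isOutside (outerRoute r a))) (r , a)

neutral-internal : ∀ r a → T (neutral a) → T (isInternal (outerRoute r a)) × T (isInternal (innerRoute r a))
neutral-internal r a = exhaustively rotationsAndLetters ∈-rotationsAndLetters
  (λ (r , a) → T? (neutral a) →-dec (T? (isInternal (outerRoute r a)) ×-dec T? (isInternal (innerRoute r a))))
  (r , a)

crossing-once : ∀ r a → Crossing a → acrossCount (outerRoute r a ∷ innerRoute r a ∷ []) ≡ 1
crossing-once r a = exhaustively rotationsAndLetters ∈-rotationsAndLetters
  (λ (r , a) → (¬? (T? (touchesOther a)) ×-dec T? (not (neutral a)))
               →-dec (acrossCount (outerRoute r a ∷ innerRoute r a ∷ []) ≟ℕ 1))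
  (r , a)

crossings-count : ∀ r {k} → All Crossing k →
  acrossCount (map (outerRoute r) k) ℕ.+ acrossCount (map (innerRoute r) k) ≡ length k
crossings-count r []                        = refl
crossings-count r {a ∷ k} (cross ∷ crosses) = begin
  acrossCount (o ∷ os) ℕ.+ acrossCount (i ∷ is′)
    ≡⟨ ≡.cong₂ ℕ._+_ (acrossCount-∷ o os) (acrossCount-∷ i is′) ⟩
  (acrossCount (o ∷ []) ℕ.+ acrossCount os) ℕ.+ (acrossCount (i ∷ []) ℕ.+ acrossCount is′)
    ≡⟨ +-interchange (acrossCount (o ∷ [])) _ _ _ ⟩
  (acrossCount (o ∷ []) ℕ.+ acrossCount (i ∷ [])) ℕ.+ (acrossCount os ℕ.+ acrossCount is′)
    ≡⟨ ≡.cong₂ ℕ._+_ (≡.trans (≡.sym (acrossCount-∷ o (i ∷ []))) (crossing-once r a cross))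
                     (crossings-count r crosses) ⟩
  suc (length k) ∎
  where
  open ≡.≡-Reasoning
  open CommutativeSemigroupₚ ℕₚ.+-commutativeSemigroup using () renaming (interchange to +-interchange)
  o i : Route
  o = outerRoute r a
  i = innerRoute r a
  os is′ : List Route
  os  = map (outerRoute r) k
  is′ = map (innerRoute r) k

topValue-crossings : ∀ s {k} → All Crossing k → length k ≢ 2 → topValue s k ≡ 0ᵛ
topValue-crossings (shape c₁ c₂ r) {k} crosses |k|≢2
  with rootValue c₁ (map (outerRoute r) k) in outer≡ | rootValue c₂ (map (innerRoute r) k) in inner≡
... | 0ᵛ  | _   = refl
... | ± _ | 0ᵛ  = refl
... | ± _ | ± _ = ⊥-elim (|k|≢2 (begin
  length k
    ≡⟨ crossings-count r crosses ⟨
  acrossCount (map (outerRoute r) k) ℕ.+ acrossCount (map (innerRoute r) k)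
    ≡⟨ ≡.cong₂ ℕ._+_ (rootValue-nonzero c₁ (map (outerRoute r) k) outer≡)
                     (rootValue-nonzero c₂ (map (innerRoute r) k) inner≡) ⟩
  2 ∎))
  where open ≡.≡-Reasoning

topValue-touchesOther : ∀ s {l} → Any (T ∘ touchesOther) l → topValue s l ≡ 0ᵛ
topValue-touchesOther (shape c₁ c₂ r) {l} touches =
  ≡.cong (λ F → maybe′ exactlyOne 0ᵛ F *ᵛ rootValue c₂ (map (innerRoute r) l))
         (rootFlags-outside c₁ (Any.map⁺ (Any.map (λ {a} → outer-touchesOther r a) touches)))

topValue-drop-neutral : ∀ s l → topValue s (filterᵇ (not ∘ neutral) l) ≡ topValue s l
topValue-drop-neutral (shape c₁ c₂ r) l = ≡.cong₂ _*ᵛ_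
  (≡.cong (maybe′ exactlyOne 0ᵛ) (rootFlags-drop c₁ (outerRoute r) neutral (λ a → proj₁ ∘ neutral-internal r a) l))
  (≡.cong (maybe′ exactlyOne 0ᵛ) (rootFlags-drop c₂ (innerRoute r) neutral (λ a → proj₂ ∘ neutral-internal r a) l))

letters-balanced : ∀ shapes → (∀ a b → Balanced (map (λ s → topValue s (a ∷ b ∷ [])) shapes)) →
  ∀ l → Balanced (map (λ s → topValue s l) shapes)
letters-balanced shapes pairs l with Any.any? (T? ∘ touchesOther) l
... | yes touches = balanced-zeros (map⁺ (All.universal (λ s → topValue-touchesOther s touches) shapes))
... | no ¬touches = ≡.subst Balanced (map-cong (λ s → topValue-drop-neutral s l) shapes)
                      (balanced-crossing (filterᵇ (not ∘ neutral) l) crosses)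
  where
  crosses : All Crossing (filterᵇ (not ∘ neutral) l)
  crosses = All.zip (filter⁺ _ (¬Any⇒All¬ l ¬touches) , all-filter (T? ∘ not ∘ neutral) l)
  zeros : ∀ {k} → All Crossing k → length k ≢ 2 → Balanced (map (λ s → topValue s k) shapes)
  zeros crosses |k|≢2 = balanced-zeros (map⁺ (All.universal (λ s → topValue-crossings s crosses |k|≢2) shapes))
  balanced-crossing : ∀ k → All Crossing k → Balanced (map (λ s → topValue s k) shapes)
  balanced-crossing (a ∷ b ∷ [])    _       = pairs a b
  balanced-crossing []              crosses = zeros crosses (λ ())
  balanced-crossing (_ ∷ [])        crosses = zeros crosses (λ ())
  balanced-crossing (_ ∷ _ ∷ _ ∷ _) crosses = zeros crosses (λ ())

pairs-balanced : ∀ shapes →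
  {True (all? (λ (a , b) → balanced? (map (λ s → topValue s (a ∷ b ∷ [])) shapes))
              (cartesianProduct allLetters allLetters))} →
  ∀ a b → Balanced (map (λ s → topValue s (a ∷ b ∷ [])) shapes)
pairs-balanced shapes {ok} a b =
  exhaustively (cartesianProduct allLetters allLetters)
    (λ (a , b) → ∈-cartesianProduct⁺ (∈-allLetters a) (∈-allLetters b))
    (λ (a , b) → balanced? (map (λ s → topValue s (a ∷ b ∷ [])) shapes)) {ok} (a , b)

jacobiShapes : Color → Color → List Shape
jacobiShapes c₁ c₂ = map (shape c₁ c₂) allRotations

jacobi-letters : ∀ c l → Balanced (map (λ s → topValue s l) (jacobiShapes c c))
jacobi-letters red  = letters-balanced (jacobiShapes red red) (pairs-balanced (jacobiShapes red red))
jacobi-letters blue = letters-balanced (jacobiShapes blue blue) (pairs-balanced (jacobiShapes blue blue))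

mixed-jacobi-letters : ∀ l → Balanced (map (λ s → topValue s l) (jacobiShapes red blue ++ jacobiShapes blue red))
mixed-jacobi-letters = letters-balanced (jacobiShapes red blue ++ jacobiShapes blue red)
  (pairs-balanced (jacobiShapes red blue ++ jacobiShapes blue red))

jacobiTerm : ∀ {n} → Shape → Tree n → Tree n → Tree n → Tree n
jacobiTerm (shape c₁ c₂ r) x y z = let (u , v , w) = rotate r x y z in node c₁ u (node c₂ v w)

module _ {n : ℕ} where

  ↾-node : ∀ c (V W S : Tree n) G → (∀ i → T (memT S i) → T (memT V i ∨ memT W i)) →
    G ↾ node c V W ↾ S ≡ G ↾ S
  ↾-node c V W S G S⊆V∪W = filterᵇ-absorb {p = within (memT S)} {q = within (memT (node c V W))} inside G
    where
    inside : ∀ e → T (within (memT S) e) → T (within (memT (node c V W)) e)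
    inside (i ⟶ j ∶ _) s rewrite memT-node c V W i | memT-node c V W j =
      let (si , sj) = to T-∧ s in from T-∧ (S⊆V∪W i si , S⊆V∪W j sj)

  value-two-level : ∀ c₁ c₂ (u v w : Tree n) → Disjoint u v → Disjoint u w → Disjoint v w → ∀ G →
    value G (node c₁ u (node c₂ v w))
    ≡ value (G ↾ u) u *ᵛ value (G ↾ v) v *ᵛ value (G ↾ w) w
      *ᵛ (rootValue c₁ (map (route (memT u) (memT (node c₂ v w))) G)
          *ᵛ rootValue c₂ (map (route (memT v) (memT w)) (G ↾ node c₂ v w)))
  value-two-level c₁ c₂ u v w u#v u#w v#w G = begin
    value G (node c₁ u N)                   ≡⟨ value-node-disjoint c₁ u N (Disjoint-node c₂ u v w u#v u#w) G ⟩
    A₁ *ᵛ Pu *ᵛ value (G ↾ N) N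
      ≡⟨ ≡.cong (A₁ *ᵛ Pu *ᵛ_) (value-node-disjoint c₂ v w v#w (G ↾ N)) ⟩
    A₁ *ᵛ Pu *ᵛ (A₂ *ᵛ value (G ↾ N ↾ v) v *ᵛ value (G ↾ N ↾ w) w)
      ≡⟨ ≡.cong₂ (λ Gv Gw → A₁ *ᵛ Pu *ᵛ (A₂ *ᵛ value Gv v *ᵛ value Gw w))
                 (↾-node c₂ v w v G (λ _ vi → from T-∨ (inj₁ vi)))
                 (↾-node c₂ v w w G (λ _ wi → from T-∨ (inj₂ wi))) ⟩
    A₁ *ᵛ Pu *ᵛ (A₂ *ᵛ Pv *ᵛ Pw)            ≡⟨ ≡.cong (A₁ *ᵛ Pu *ᵛ_) (*ᵛ-assoc A₂ Pv Pw) ⟩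
    A₁ *ᵛ Pu *ᵛ (A₂ *ᵛ (Pv *ᵛ Pw))          ≡⟨ interchange A₁ Pu A₂ (Pv *ᵛ Pw) ⟩
    A₁ *ᵛ A₂ *ᵛ (Pu *ᵛ (Pv *ᵛ Pw))          ≡⟨ ≡.cong (A₁ *ᵛ A₂ *ᵛ_) (*ᵛ-assoc Pu Pv Pw) ⟨
    A₁ *ᵛ A₂ *ᵛ (Pu *ᵛ Pv *ᵛ Pw)            ≡⟨ *ᵛ-comm (A₁ *ᵛ A₂) _ ⟩
    Pu *ᵛ Pv *ᵛ Pw *ᵛ (A₁ *ᵛ A₂)            ∎
    where
    open ≡.≡-Reasoning
    N : Tree n
    N = node c₂ v w
    A₁ A₂ Pu Pv Pw : Val
    A₁ = rootValue c₁ (map (route (memT u) (memT N)) G)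
    A₂ = rootValue c₂ (map (route (memT v) (memT w)) (G ↾ N))
    Pu = value (G ↾ u) u
    Pv = value (G ↾ v) v
    Pw = value (G ↾ w) w

  letter : (Fin n → Block) → Edge n → Letter
  letter blk (i ⟶ j ∶ c) = blk i , blk j , c

  module _ (blk : Fin n → Block) {u v w : Tree n} {bu bv bw : Block}
           (u≗ : memT u ≗ is bu ∘ blk) (v≗ : memT v ≗ is bv ∘ blk) (w≗ : memT w ≗ is bw ∘ blk) where

    private
      inVW : Block → Bool
      inVW b = is bv b ∨ is bw b

      vw≗ : ∀ c → memT (node c v w) ≗ inVW ∘ blk
      vw≗ c i = ≡.trans (memT-node c v w i) (≡.cong₂ _∨_ (v≗ i) (w≗ i))

    outer-letters : ∀ c c′ G →
      rootValue c (map (route (memT u) (memT (node c′ v w))) G) ≡ rootValue c (map (routeᴸ (is bu) inVW) (map (letter blk) G))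
    outer-letters c c′ G = ≡.cong (rootValue c) (≡.trans (map-cong (route-cong u≗ (vw≗ c′)) G) (map-∘ G))

    inner-letters : ∀ c G →
      rootValue c (map (route (memT v) (memT w)) (G ↾ node c v w))
      ≡ rootValue c (map (λ a → if insideᴸ inVW a then routeᴸ (is bv) (is bw) a else inLeft) (map (letter blk) G))
    inner-letters c G = ≡.cong (maybe′ exactlyOne 0ᵛ) (begin
      rootFlags c (map (route (memT v) (memT w)) (G ↾ node c v w))
        ≡⟨ ≡.cong (rootFlags c) (map-cong (route-cong v≗ w≗) (G ↾ node c v w)) ⟩
      rootFlags c (map (routeᴸ (is bv) (is bw) ∘ letter blk) (G ↾ node c v w))
        ≡⟨ ≡.cong (λ H → rootFlags c (map (routeᴸ (is bv) (is bw) ∘ letter blk) H))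
                  (filterᵇ-cong {q = insideᴸ inVW ∘ letter blk}
                                (λ (i ⟶ j ∶ _) → ≡.cong₂ _∧_ (vw≗ c i) (vw≗ c j)) G) ⟩
      rootFlags c (map (routeᴸ (is bv) (is bw) ∘ letter blk) (filterᵇ (insideᴸ inVW ∘ letter blk) G))
        ≡⟨ ≡.cong (rootFlags c) (≡.trans (map-∘ (filterᵇ (insideᴸ inVW ∘ letter blk) G))
                                         (≡.cong (map (routeᴸ (is bv) (is bw)))
                                                 (map-filterᵇ (letter blk) (insideᴸ inVW) G))) ⟩
      rootFlags c (map (routeᴸ (is bv) (is bw)) (filterᵇ (insideᴸ inVW) (map (letter blk) G)))
        ≡⟨ rootFlags-filterᵇ c (routeᴸ (is bv) (is bw)) (insideᴸ inVW) (map (letter blk) G) ⟩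
      rootFlags c (map (λ a → if insideᴸ inVW a then routeᴸ (is bv) (is bw) a else inLeft) (map (letter blk) G)) ∎)
      where open ≡.≡-Reasoning

    value-rotated : ∀ c c′ → Disjoint u v → Disjoint u w → Disjoint v w → ∀ G →
      value G (node c u (node c′ v w))
      ≡ value (G ↾ u) u *ᵛ value (G ↾ v) v *ᵛ value (G ↾ w) w
        *ᵛ (rootValue c (map (routeᴸ (is bu) inVW) (map (letter blk) G))
            *ᵛ rootValue c′ (map (λ a → if insideᴸ inVW a then routeᴸ (is bv) (is bw) a else inLeft) (map (letter blk) G)))
    value-rotated c c′ u#v u#w v#w G = ≡.trans (value-two-level c c′ u v w u#v u#w v#w G)
      (≡.cong₂ (λ a b → value (G ↾ u) u *ᵛ value (G ↾ v) v *ᵛ value (G ↾ w) w *ᵛ (a *ᵛ b))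
        (outer-letters c c′ G) (inner-letters c′ G))

module Jacobi {n : ℕ} (x y z : Tree n) (x#y : Disjoint x y) (x#z : Disjoint x z) (y#z : Disjoint y z) where

  blockOf : Fin n → Block
  blockOf i = if memT x i then X else if memT y i then Y else if memT z i then Z else other

  private
    excluded : ∀ {S U : Tree n} {i} → Disjoint S U → memT S i ≡ true → memT U i ≡ false
    excluded {i = i} S#U Si = ¬-not (λ Ui → S#U i (from T-≡ Si) (from T-≡ Ui))

  memT-x : memT x ≗ is X ∘ blockOf
  memT-x i with memT x i
  ... | true  = refl
  ... | false with memT y i
  ...   | true  = refl
  ...   | false with memT z i
  ...     | true  = refl
  ...     | false = refl

  memT-y : memT y ≗ is Y ∘ blockOf
  memT-y i with memT x i in xi
  ... | true  = excluded {x} {y} x#y xi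
  ... | false with memT y i
  ...   | true  = refl
  ...   | false with memT z i
  ...     | true  = refl
  ...     | false = refl

  memT-z : memT z ≗ is Z ∘ blockOf
  memT-z i with memT x i in xi
  ... | true  = excluded {x} {z} x#z xi
  ... | false with memT y i in yi
  ...   | true  = excluded {y} {z} y#z yi
  ...   | false with memT z i
  ...     | true  = refl
  ...     | false = refl

  P : Graph n → Val
  P G = value (G ↾ x) x *ᵛ value (G ↾ y) y *ᵛ value (G ↾ z) z

  value-jacobiTerm : ∀ s G → value G (jacobiTerm s x y z) ≡ P G *ᵛ topValue s (map (letter blockOf) G)
  value-jacobiTerm (shape c₁ c₂ xyz) G = value-rotated blockOf memT-x memT-y memT-z c₁ c₂ x#y x#z y#z G
  value-jacobiTerm (shape c₁ c₂ yzx) G = ≡.trans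
    (value-rotated blockOf memT-y memT-z memT-x c₁ c₂ y#z (Disjoint-sym {S = x} {U = y} x#y) (Disjoint-sym {S = x} {U = z} x#z) G)
    (≡.cong (_*ᵛ topValue (shape c₁ c₂ yzx) (map (letter blockOf) G))
            (xy∙z≈zx∙y (value (G ↾ y) y) (value (G ↾ z) z) (value (G ↾ x) x)))
  value-jacobiTerm (shape c₁ c₂ zxy) G = ≡.trans
    (value-rotated blockOf memT-z memT-x memT-y c₁ c₂ (Disjoint-sym {S = x} {U = z} x#z) (Disjoint-sym {S = y} {U = z} y#z) x#y G)
    (≡.cong (_*ᵛ topValue (shape c₁ c₂ zxy) (map (letter blockOf) G))
            (xy∙z≈yz∙x (value (G ↾ z) z) (value (G ↾ x) x) (value (G ↾ y) y)))

  jacobi-balanced : ∀ shapes → (∀ l → Balanced (map (λ s → topValue s l) shapes)) →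
    ∀ G → Balanced (map (λ s → value G (jacobiTerm s x y z)) shapes)
  jacobi-balanced shapes letters G =
    ≡.subst Balanced
      (≡.sym (≡.trans (map-cong (λ s → value-jacobiTerm s G) shapes)
                      (map-∘ {g = P G *ᵛ_} {f = λ s → topValue s (map (letter blockOf) G)} shapes)))
      (balanced-*ᵛˡ (P G) (map (λ s → topValue s (map (letter blockOf) G)) shapes) (letters (map (letter blockOf) G)))

-- Generators of J_n

module _ {n : ℕ} where

  memT-∈ : ∀ (S : Tree n) {i} → T (memT S i) → i ∈ leaves S
  memT-∈ (leaf k) {i} _ with k ≟F i
  ... | yes refl = here refl
  memT-∈ (node c L R) {i} Si with to T-∨ (≡.subst T (memT-node c L R i) Si)
  ... | inj₁ Li = ∈-++⁺ˡ (memT-∈ L Li)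
  ... | inj₂ Ri = ∈-++⁺ʳ (leaves L) (memT-∈ R Ri)

Unique-++⁻ : ∀ {A : Set} (xs : List A) {ys} → Unique (xs ++ ys) →
  Unique xs × Unique ys × (∀ {a} → a ∈ xs → a ∉ ys)
Unique-++⁻ []       u        = [] , u , λ ()
Unique-++⁻ (x ∷ xs) (x∉ ∷ u) =
  let (uxs , uys , xs#ys) = Unique-++⁻ xs u in
  (++⁻ˡ xs x∉ ∷ uxs) , uys , λ { (here refl)  a∈ys → All.lookup (++⁻ʳ xs x∉) a∈ys refl
                               ; (there a∈xs)      → xs#ys a∈xs }

module _ {n : ℕ} where

  Valid⇒Unique : ∀ (S : Tree n) → Valid S → Unique (leaves S)
  Valid⇒Unique S valid = Permutation.Unique-resp-↭ (≡.setoid (Fin n)) (↭⇒↭ₛ (↭-sym valid)) (allFin⁺ n)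

  Unique-plug : ∀ (C : Ctx n) t → Unique (leaves (plug C t)) → Unique (leaves t)
  Unique-plug hole        t u = u
  Unique-plug (inL c C r) t u = Unique-plug C t (proj₁ (Unique-++⁻ (leaves (plug C t)) u))
  Unique-plug (inR c l C) t u = Unique-plug C t (proj₁ (proj₂ (Unique-++⁻ (leaves l) u)))

  Disjoint-leaves : ∀ (S U : Tree n) → (∀ {i} → i ∈ leaves S → i ∉ leaves U) → Disjoint S U
  Disjoint-leaves S U S#U i Si Ui = S#U (memT-∈ S Si) (memT-∈ U Ui)

  pairwise-disjoint : ∀ (x y z : Tree n) → Unique (leaves x ++ (leaves y ++ leaves z)) →
    Disjoint x y × Disjoint x z × Disjoint y z
  pairwise-disjoint x y z u =
    let (_ , uyz , x#yz) = Unique-++⁻ (leaves x) u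
        (_ , _ , y#z)    = Unique-++⁻ (leaves y) uyz
    in Disjoint-leaves x y (λ i∈x i∈y → x#yz i∈x (∈-++⁺ˡ i∈y)) ,
       Disjoint-leaves x z (λ i∈x i∈z → x#yz i∈x (∈-++⁺ʳ (leaves y) i∈z)) ,
       Disjoint-leaves y z y#z

  private
    memT-node² : ∀ c₁ c₂ (u v w : Tree n) i → memT (node c₁ u (node c₂ v w)) i ≡ memT u i ∨ (memT v i ∨ memT w i)
    memT-node² c₁ c₂ u v w i = ≡.trans (memT-node c₁ u (node c₂ v w) i) (≡.cong (memT u i ∨_) (memT-node c₂ v w i))

    open CommutativeSemigroupₚ (CommutativeMonoid.commutativeSemigroup ∨-commutativeMonoid)
      using () renaming (x∙yz≈z∙xy to ∨-rotateʳ; x∙yz≈y∙zx to ∨-rotateˡ)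

  memT-jacobiTerm : ∀ s (x y z : Tree n) → memT (jacobiTerm s x y z) ≗ λ i → memT x i ∨ (memT y i ∨ memT z i)
  memT-jacobiTerm (shape c₁ c₂ xyz) x y z i = memT-node² c₁ c₂ x y z i
  memT-jacobiTerm (shape c₁ c₂ yzx) x y z i =
    ≡.trans (memT-node² c₁ c₂ y z x i) (∨-rotateʳ (memT y i) (memT z i) (memT x i))
  memT-jacobiTerm (shape c₁ c₂ zxy) x y z i =
    ≡.trans (memT-node² c₁ c₂ z x y i) (∨-rotateˡ (memT z i) (memT x i) (memT y i))

  plugged-antisymmetry : ∀ (C : Ctx n) c x y → Valid (plug C (node c x y)) →
    ∀ G → Balanced (map (value G) (map (plug C) (node c x y ∷ node c y x ∷ [])))
  plugged-antisymmetry C c x y valid =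
    balanced-plug C _ (λ i → memT x i ∨ memT y i)
      (memT-node c x y ∷ (λ i → ≡.trans (memT-node c y x i) (∨-comm (memT y i) (memT x i))) ∷ [])
      (antisymmetry-balanced c x y x#y)
    where
    x#y : Disjoint x y
    x#y = Disjoint-leaves x y
      (proj₂ (proj₂ (Unique-++⁻ (leaves x) (Unique-plug C (node c x y) (Valid⇒Unique (plug C (node c x y)) valid)))))

  plugged-jacobi : ∀ (C : Ctx n) c₁ c₂ x y z → Valid (plug C (node c₁ x (node c₂ y z))) →
    ∀ shapes → (∀ l → Balanced (map (λ s → topValue s l) shapes)) →
    ∀ G → Balanced (map (value G) (map (plug C) (map (λ s → jacobiTerm s x y z) shapes)))
  plugged-jacobi C c₁ c₂ x y z valid shapes letters
    with pairwise-disjoint x y z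
           (Unique-plug C (node c₁ x (node c₂ y z)) (Valid⇒Unique (plug C (node c₁ x (node c₂ y z))) valid))
  ... | x#y , x#z , y#z =
    balanced-plug C _ (λ i → memT x i ∨ (memT y i ∨ memT z i))
      (map⁺ (All.universal (λ s → memT-jacobiTerm s x y z) shapes))
      (λ G → ≡.subst Balanced (map-∘ shapes) (Jacobi.jacobi-balanced x y z x#y x#z y#z shapes letters G))

  generator-balanced : ∀ (G : Graph n) (g : Generator n) → Balanced (map (value G) (genTrees g))
  generator-balanced G record { ctx = C ; rel = S1 x y   ; valid = v ∷ _ } = plugged-antisymmetry C red x y v G
  generator-balanced G record { ctx = C ; rel = S2 x y   ; valid = v ∷ _ } = plugged-antisymmetry C blue x y v G
  generator-balanced G record { ctx = C ; rel = J1 x y z ; valid = v ∷ _ } =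
    plugged-jacobi C red red x y z v (jacobiShapes red red) (jacobi-letters red) G
  generator-balanced G record { ctx = C ; rel = J2 x y z ; valid = v ∷ _ } =
    plugged-jacobi C blue blue x y z v (jacobiShapes blue blue) (jacobi-letters blue) G
  generator-balanced G record { ctx = C ; rel = MJ x y z ; valid = v ∷ _ } =
    plugged-jacobi C red blue x y z v (jacobiShapes red blue ++ jacobiShapes blue red) mixed-jacobi-letters G

-- Linearity

module Linearity {c ℓ : Level} (R : CommutativeRing c ℓ) where

  open CommutativeRing R renaming (refl to ≈-refl) hiding (zero)
  open import Relation.Binary.Reasoning.Setoid setoid
  open import Algebra.Properties.Ring ring using (-‿involutive; -0#≈0#; -‿+-comm; -‿distribˡ-*; x∙y⁻¹≈ε⇒x≈y)
  open import Algebra.Definitions.RawMonoid +-rawMonoid using () renaming (_×_ to _·_)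
  open CommutativeSemigroupₚ +-commutativeSemigroup using (x∙yz≈y∙xz)

  ι : Val → Carrier
  ι 0ᵛ         = 0#
  ι (± Sign.+) = 1#
  ι (± Sign.-) = - 1#

  signPow≈ι : ∀ k → signPow R k ≈ ι (± sign^ k)
  signPow≈ι zero    = ≈-refl
  signPow≈ι (suc k) with sign^ k | signPow≈ι k
  ... | Sign.+ | p = -‿cong p
  ... | Sign.- | p = trans (-‿cong p) (-‿involutive 1#)

  pairBasis≈ι : ∀ {n} (G : Graph n) T → pairBasis R G T ≈ ι (value G T)
  pairBasis≈ι G T with allInfos T G
  ... | nothing = ≈-refl
  ... | just xs with eachOnce (internalAddrs T) xs
  ...   | true  = signPow≈ι (countCCW xs)
  ...   | false = ≈-refl

  ∑ : List Carrier → Carrier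
  ∑ = foldr _+_ 0#

  ∑-++ : ∀ xs ys → ∑ (xs ++ ys) ≈ ∑ xs + ∑ ys
  ∑-++ []       ys = sym (+-identityˡ _)
  ∑-++ (x ∷ xs) ys = trans (+-congˡ (∑-++ xs ys)) (sym (+-assoc _ _ _))

  ∑-pairBasis : ∀ {n} (G : Graph n) ts → ∑ (map (pairBasis R G) ts) ≈ ∑ (map ι (map (value G) ts))
  ∑-pairBasis G []       = ≈-refl
  ∑-pairBasis G (t ∷ ts) = +-cong (pairBasis≈ι G t) (∑-pairBasis G ts)

  ∑ι+#⁻≈#⁺ : ∀ vs → ∑ (map ι vs) + #⁻ vs · 1# ≈ #⁺ vs · 1#
  ∑ι+#⁻≈#⁺ []              = +-identityˡ 0#
  ∑ι+#⁻≈#⁺ (0ᵛ ∷ vs)       = trans (+-congʳ (+-identityˡ _)) (∑ι+#⁻≈#⁺ vs)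
  ∑ι+#⁻≈#⁺ (± Sign.+ ∷ vs) = trans (+-assoc 1# _ _) (+-congˡ (∑ι+#⁻≈#⁺ vs))
  ∑ι+#⁻≈#⁺ (± Sign.- ∷ vs) = begin
    (- 1# + s) + (1# + m) ≈⟨ +-assoc (- 1#) s _ ⟩
    - 1# + (s + (1# + m)) ≈⟨ +-congˡ (x∙yz≈y∙xz s 1# m) ⟩
    - 1# + (1# + (s + m)) ≈⟨ +-assoc (- 1#) 1# _ ⟨
    (- 1# + 1#) + (s + m) ≈⟨ +-congʳ (-‿inverseˡ 1#) ⟩
    0# + (s + m)          ≈⟨ +-identityˡ _ ⟩
    s + m                 ≈⟨ ∑ι+#⁻≈#⁺ vs ⟩
    #⁺ vs · 1#            ∎
    where
    s m : Carrier
    s = ∑ (map ι vs)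
    m = #⁻ vs · 1#

  ∑-balanced : ∀ vs → Balanced vs → ∑ (map ι vs) ≈ 0#
  ∑-balanced vs balanced = begin
    s              ≈⟨ +-identityʳ s ⟨
    s + 0#         ≈⟨ +-congˡ (-‿inverseʳ m) ⟨
    s + (m - m)    ≈⟨ +-assoc s m (- m) ⟨
    (s + m) - m    ≈⟨ +-congʳ (∑ι+#⁻≈#⁺ vs) ⟩
    #⁺ vs · 1# - m ≡⟨ ≡.cong (λ k → k · 1# - m) balanced ⟩
    m - m          ≈⟨ -‿inverseʳ m ⟩
    0#             ∎
    where
    s m : Carrier
    s = ∑ (map ι vs)
    m = #⁻ vs · 1#

  module _ {n : ℕ} (f : Tree n → Carrier) where

    weigh : Carrier × Tree n → Carrier
    weigh (r , S) = r * f S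

    evaluate : Θ R n → Carrier
    evaluate α = ∑ (map weigh α)

    remove : Tree n → Θ R n → Θ R n
    remove S = filter (λ (_ , S′) → ¬? (S′ ≟T S))

    evaluate-remove : ∀ S (γ : Θ R n) → evaluate γ ≈ coeff R γ S * f S + evaluate (remove S γ)
    evaluate-remove S []             = sym (trans (+-identityʳ _) (zeroˡ _))
    evaluate-remove S ((r , S′) ∷ γ) with S′ ≟T S
    ... | yes refl = begin
      r * f S + evaluate γ                                  ≈⟨ +-congˡ (evaluate-remove S γ) ⟩
      r * f S + (coeff R γ S * f S + evaluate (remove S γ)) ≈⟨ +-assoc _ _ _ ⟨
      (r * f S + coeff R γ S * f S) + evaluate (remove S γ) ≈⟨ +-congʳ (distribʳ (f S) r _) ⟨
      (r + coeff R γ S) * f S + evaluate (remove S γ)       ∎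
    ... | no _ = trans (+-congˡ (evaluate-remove S γ)) (x∙yz≈y∙xz _ _ _)

    coeff-remove-self : ∀ S (γ : Θ R n) → coeff R (remove S γ) S ≡ 0#
    coeff-remove-self S []             = refl
    coeff-remove-self S ((r , S′) ∷ γ) with S′ ≟T S
    ... | yes _   = coeff-remove-self S γ
    ... | no S′≢S with S′ ≟T S
    ...   | yes S′≡S = ⊥-elim (S′≢S S′≡S)
    ...   | no _     = coeff-remove-self S γ

    coeff-remove-other : ∀ {S U} (γ : Θ R n) → S ≢ U → coeff R (remove S γ) U ≡ coeff R γ U
    coeff-remove-other [] _ = refl
    coeff-remove-other {S} {U} ((r , S′) ∷ γ) S≢U with S′ ≟T S
    ... | yes refl with S′ ≟T U
    ...   | yes S≡U = ⊥-elim (S≢U S≡U)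
    ...   | no _    = coeff-remove-other γ S≢U
    coeff-remove-other {S} {U} ((r , S′) ∷ γ) S≢U | no _ with S′ ≟T U
    ...   | yes _ = ≡.cong (r +_) (coeff-remove-other γ S≢U)
    ...   | no _  = coeff-remove-other γ S≢U

    evaluate-zero : ∀ k (γ : Θ R n) → length γ ≤ k → (∀ U → coeff R γ U ≈ 0#) → evaluate γ ≈ 0#
    evaluate-zero _       []               _            _   = ≈-refl
    evaluate-zero (suc k) γ@((r , S) ∷ γ′) (s≤s |γ′|≤k) γ≈0 = begin
      evaluate γ                                ≈⟨ evaluate-remove S γ ⟩
      coeff R γ S * f S + evaluate (remove S γ) ≈⟨ +-cong (trans (*-congʳ (γ≈0 S)) (zeroˡ (f S))) γ∖S≈0 ⟩
      0# + 0#                                   ≈⟨ +-identityˡ 0# ⟩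
      0#                                        ∎
      where
      γ∖S≡γ′∖S : remove S γ ≡ remove S γ′
      γ∖S≡γ′∖S = filter-reject (λ (_ , S′) → ¬? (S′ ≟T S)) (λ S≢S → S≢S refl)
      coeff-γ∖S : ∀ U → coeff R (remove S γ) U ≈ 0#
      coeff-γ∖S U with S ≟T U
      ... | yes refl = reflexive (coeff-remove-self S γ)
      ... | no S≢U   = trans (reflexive (coeff-remove-other γ S≢U)) (γ≈0 U)
      |γ∖S|≤k : length (remove S γ) ≤ k
      |γ∖S|≤k =
        ℕₚ.≤-trans (ℕₚ.≤-reflexive (≡.cong length γ∖S≡γ′∖S)) (ℕₚ.≤-trans (length-filter _ γ′) |γ′|≤k)
      γ∖S≈0 : evaluate (remove S γ) ≈ 0#
      γ∖S≈0 = evaluate-zero k (remove S γ) |γ∖S|≤k coeff-γ∖S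

    negate : Θ R n → Θ R n
    negate = map (λ (r , S) → - r , S)

    coeff-++ : ∀ (α β : Θ R n) U → coeff R (α ++ β) U ≈ coeff R α U + coeff R β U
    coeff-++ []             β U = sym (+-identityˡ _)
    coeff-++ ((r , S) ∷ α) β U with S ≟T U
    ... | yes _ = trans (+-congˡ (coeff-++ α β U)) (sym (+-assoc _ _ _))
    ... | no _  = coeff-++ α β U

    coeff-negate : ∀ (β : Θ R n) U → coeff R (negate β) U ≈ - coeff R β U
    coeff-negate []             U = sym -0#≈0#
    coeff-negate ((r , S) ∷ β) U with S ≟T U
    ... | yes _ = trans (+-congˡ (coeff-negate β U)) (-‿+-comm r _)
    ... | no _  = coeff-negate β U

    evaluate-++ : ∀ (α β : Θ R n) → evaluate (α ++ β) ≈ evaluate α + evaluate β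
    evaluate-++ α β = trans (reflexive (≡.cong ∑ (map-++ weigh α β))) (∑-++ (map weigh α) (map weigh β))

    evaluate-negate : ∀ (β : Θ R n) → evaluate (negate β) ≈ - evaluate β
    evaluate-negate []             = sym -0#≈0#
    evaluate-negate ((r , S) ∷ β) = trans (+-cong (sym (-‿distribˡ-* r (f S))) (evaluate-negate β)) (-‿+-comm _ _)

    evaluate-cong : ∀ (α β : Θ R n) → (∀ U → coeff R α U ≈ coeff R β U) → evaluate α ≈ evaluate β
    evaluate-cong α β α≈β = x∙y⁻¹≈ε⇒x≈y _ _ (begin
      evaluate α - evaluate β          ≈⟨ +-congˡ (evaluate-negate β) ⟨
      evaluate α + evaluate (negate β) ≈⟨ evaluate-++ α (negate β) ⟨
      evaluate (α ++ negate β)         ≈⟨ evaluate-zero _ (α ++ negate β) ℕₚ.≤-refl α-β≈0 ⟩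
      0#                               ∎)
      where
      α-β≈0 : ∀ U → coeff R (α ++ negate β) U ≈ 0#
      α-β≈0 U = begin
        coeff R (α ++ negate β) U          ≈⟨ coeff-++ α (negate β) U ⟩
        coeff R α U + coeff R (negate β) U ≈⟨ +-cong (α≈β U) (coeff-negate β U) ⟩
        coeff R β U - coeff R β U          ≈⟨ -‿inverseʳ _ ⟩
        0#                                 ∎

    evaluate-scaled : ∀ r ts → evaluate (map (λ S → r , S) ts) ≈ r * ∑ (map f ts)
    evaluate-scaled r []       = sym (zeroʳ r)
    evaluate-scaled r (S ∷ ts) = trans (+-congˡ (evaluate-scaled r ts)) (sym (distribˡ r _ _))

    evaluate-J : (∀ g → ∑ (map f (genTrees g)) ≈ 0#) → ∀ (α : Θ R n) → InJ R α → evaluate α ≈ 0#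
    evaluate-J g≈0 α (gs , α≈gs) = trans (evaluate-cong α (expand R gs) α≈gs) (evaluate-expand gs)
      where
      evaluate-expand : ∀ (gs : List (Carrier × Generator n)) → evaluate (expand R gs) ≈ 0#
      evaluate-expand []             = ≈-refl
      evaluate-expand ((r , g) ∷ gs) = begin
        evaluate (rg ++ expand R gs)         ≈⟨ evaluate-++ rg (expand R gs) ⟩
        evaluate rg + evaluate (expand R gs) ≈⟨ +-cong (evaluate-scaled r (genTrees g)) (evaluate-expand gs) ⟩
        r * ∑ (map f (genTrees g)) + 0#      ≈⟨ +-congʳ (trans (*-congˡ (g≈0 g)) (zeroʳ r)) ⟩
        0# + 0#                              ≈⟨ +-identityˡ 0# ⟩
        0#                                   ∎
        where
        rg : Θ R n
        rg = map (λ S → r , S) (genTrees g)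

    ∑-scaled : ∀ r (α : Θ R n) → ∑ (map (λ (s , S) → (r * s) * f S) α) ≈ r * evaluate α
    ∑-scaled r []             = sym (zeroʳ r)
    ∑-scaled r ((s , S) ∷ α) = trans (+-cong (*-assoc r s (f S)) (∑-scaled r α)) (sym (distribˡ r _ _))

  pairing≈0 : ∀ {n} (β : Γ R n) (α : Θ R n) → InJ R α →
    (∀ (G : Graph n) (g : Generator n) → ∑ (map (pairBasis R G) (genTrees g)) ≈ 0#) →
    pairing R β α ≈ 0#
  pairing≈0 []             _ _   _   = ≈-refl
  pairing≈0 ((r , G) ∷ β) α α∈J g≈0 = begin
    ∑ (first ++ rest)                   ≈⟨ ∑-++ first rest ⟩
    ∑ first + pairing R β α             ≈⟨ +-cong (∑-scaled (pairBasis R G) r α) (pairing≈0 β α α∈J g≈0) ⟩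
    r * evaluate (pairBasis R G) α + 0#
      ≈⟨ +-congʳ (trans (*-congˡ (evaluate-J (pairBasis R G) (g≈0 G) α α∈J)) (zeroʳ r)) ⟩
    0# + 0#                             ≈⟨ +-identityˡ 0# ⟩
    0#                                  ∎
    where
    first rest : List Carrier
    first = map (λ (s , S) → (r * s) * pairBasis R G S) α
    rest  = concatMap (λ (r′ , G′) → map (λ (s , S) → (r′ * s) * pairBasis R G′ S) α) β

proposition5p9 : ∀ {c ℓ : Level} (R : CommutativeRing c ℓ) (n : ℕ)
    (β : Γ R n) (α : Θ R n) → InΘ R α → InJ R α →
    CommutativeRing._≈_ R (pairing R β α) (CommutativeRing.0# R)
proposition5p9 R n β α _ α∈J = pairing≈0 β α α∈J λ G g →
  trans (∑-pairBasis G (genTrees g)) (∑-balanced (map (value G) (genTrees g)) (generator-balanced G g))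
  where
  open CommutativeRing R using (trans)
  open Linearity R
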